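{- Let $G$ be a finite graph. Then $\mu(G)=\nu(G)$ if and only if $e(G)=e_p(G)$.
   Context: $\nu(G)$ is the maximum size of a matching. $\lambda(G)=\max\{|H|+|H'| : H,H' \text{ disjoint matchings of } G\}$, $\Lambda(G)$ the set of pairs of disjoint matchings $(H,H')$ with $|H|+|H'|=\lambda(G)$, $\mu(G)=\max\{|H|:(H,H')\in\Lambda(G)\}$. A pec decomposition of $G=(V,E)$ is a spanning subgraph $G'=(V,E')$, $E'\subseteq E$, whose connected components are paths or even-length cycles (an isolated vertex is a path of length $0$, hence even). $p(G')$, $e(G')$ are the numbers of components that are paths, resp. even paths; $p(G)=\min p(G')$, $e(G)=\min e(G')$ over pec decompositions, and $e_p(G)=\min\{e(G') : p(G')=p(G)\}$. -}

module Defs where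

open import Data.Nat using (ℕ; zero; suc; _+_; _≤_)
open import Data.Nat.Divisibility using (_∣_)
open import Data.Fin using (Fin; zero; suc; inject₁; fromℕ)
open import Data.Fin.Subset using (Subset; _∈_; _∉_; ∣_∣)
open import Data.Product using (Σ; ∃; ∃-syntax; _×_; _,_; proj₁; proj₂)
open import Data.Sum using (_⊎_)
open import Relation.Binary.PropositionalEquality using (_≡_; _≢_)
open import Relation.Nullary using (¬_)
open import Function.Bundles using (_⇔_)
open import Function.Definitions using (Injective)

-- A finite loopless multigraph on vertex set Fin n with edge set Fin m.
-- (Simple graphs are the special case where no two edges have the same ends.)
record Graph (n m : ℕ) : Set where
  field
    src tgt  : Fin m → Fin n
    loopless : ∀ e → src e ≢ tgt e

module _ {n m : ℕ} (G : Graph n m) where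
  open Graph G

  Incident : Fin m → Fin n → Set
  Incident e v = src e ≡ v ⊎ tgt e ≡ v

  Links : Fin m → Fin n → Fin n → Set
  Links e u w = (src e ≡ u × tgt e ≡ w) ⊎ (src e ≡ w × tgt e ≡ u)

  IsMatching : Subset m → Set
  IsMatching H = ∀ e f → e ∈ H → f ∈ H → e ≢ f → ∀ v → Incident e v → ¬ Incident f v

  EdgeDisjoint : Subset m → Subset m → Set
  EdgeDisjoint H H′ = ∀ e → e ∈ H → e ∉ H′

  DisjPair : Subset m → Subset m → Set
  DisjPair H H′ = IsMatching H × IsMatching H′ × EdgeDisjoint H H′

  IsNu : ℕ → Set
  IsNu k = (∃[ H ] (IsMatching H × ∣ H ∣ ≡ k))
         × (∀ H → IsMatching H → ∣ H ∣ ≤ k)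

  -- (H , H′) ∈ Λ(G): a pair of disjoint matchings with |H|+|H′| = λ(G)
  InΛ : Subset m → Subset m → Set
  InΛ H H′ = DisjPair H H′ × (∀ K K′ → DisjPair K K′ → ∣ K ∣ + ∣ K′ ∣ ≤ ∣ H ∣ + ∣ H′ ∣)

  IsMu : ℕ → Set
  IsMu k = (∃[ H ] ∃[ H′ ] (InΛ H H′ × ∣ H ∣ ≡ k))
         × (∀ H H′ → InΛ H H′ → ∣ H ∣ ≤ k)

  data Reach (E′ : Subset m) (v : Fin n) : Fin n → Set where
    here : Reach E′ v v
    step : ∀ {u w} e → e ∈ E′ → Links e u w → Reach E′ v u → Reach E′ v w

  -- The component of v in (V , E′) is a path of length k (k edges):
  -- its vertices are x 0 , … , x k (distinct), and its edges are exactly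
  -- the distinct edges ed 0 , … , ed (k-1), where ed i joins x i and x (i+1).
  IsPathComp : Subset m → Fin n → ℕ → Set
  IsPathComp E′ v k =
    Σ (Fin (suc k) → Fin n) λ x → Injective _≡_ _≡_ x
    × (∀ u → Reach E′ v u ⇔ (∃[ i ] x i ≡ u))
    × Σ (Fin k → Fin m) λ ed → Injective _≡_ _≡_ ed
      × (∀ i → ed i ∈ E′ × Links (ed i) (x (inject₁ i)) (x (suc i)))
      × (∀ e → e ∈ E′ → (∃[ u ] (Reach E′ v u × Incident e u)) → ∃[ i ] ed i ≡ e)

  -- The component of v in (V , E′) is a cycle of length (suc l):
  -- distinct vertices y 0 , … , y l, and its edges are exactly the distinct
  -- edges ed 0 , … , ed l, where ed i joins y i and y (i+1) (indices mod suc l).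
  IsCycleComp : Subset m → Fin n → ℕ → Set
  IsCycleComp E′ v l =
    Σ (Fin (suc l) → Fin n) λ y → Injective _≡_ _≡_ y
    × (∀ u → Reach E′ v u ⇔ (∃[ i ] y i ≡ u))
    × Σ (Fin (suc l) → Fin m) λ ed → Injective _≡_ _≡_ ed
      × (∀ i → ed i ∈ E′)
      × (∀ (i : Fin l) → Links (ed (inject₁ i)) (y (inject₁ i)) (y (suc i)))
      × Links (ed (fromℕ l)) (y (fromℕ l)) (y zero)
      × (∀ e → e ∈ E′ → (∃[ u ] (Reach E′ v u × Incident e u)) → ∃[ i ] ed i ≡ e)

  PathComp : Subset m → Fin n → Set
  PathComp E′ v = ∃[ k ] IsPathComp E′ v k

  EvenPathComp : Subset m → Fin n → Set
  EvenPathComp E′ v = ∃[ k ] (IsPathComp E′ v k × 2 ∣ k)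

  EvenCycleComp : Subset m → Fin n → Set
  EvenCycleComp E′ v = ∃[ l ] (IsCycleComp E′ v l × 2 ∣ suc l)

  IsPec : Subset m → Set
  IsPec E′ = ∀ v → PathComp E′ v ⊎ EvenCycleComp E′ v

  -- The number of components of (V , E′) whose component satisfies P is c:
  -- representatives r 0 , … , r (c-1) lie in pairwise distinct components,
  -- each satisfying P, and every component satisfying P contains one of them.
  CompCount : (E′ : Subset m) → (Fin n → Set) → ℕ → Set
  CompCount E′ P c =
    Σ (Fin c → Fin n) λ r →
      (∀ i j → Reach E′ (r i) (r j) → i ≡ j)
    × (∀ i → P (r i))
    × (∀ v → P v → ∃[ i ] Reach E′ (r i) v)

  PCount : Subset m → ℕ → Set
  PCount E′ c = CompCount E′ (PathComp E′) c

  ECount : Subset m → ℕ → Set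
  ECount E′ c = CompCount E′ (EvenPathComp E′) c

  IsP : ℕ → Set
  IsP c = (∃[ E′ ] (IsPec E′ × PCount E′ c))
        × (∀ E′ c′ → IsPec E′ → PCount E′ c′ → c ≤ c′)

  IsE : ℕ → Set
  IsE c = (∃[ E′ ] (IsPec E′ × ECount E′ c))
        × (∀ E′ c′ → IsPec E′ → ECount E′ c′ → c ≤ c′)

  IsEp : ℕ → Set
  IsEp c = ∃[ p ] (IsP p
        × (∃[ E′ ] (IsPec E′ × PCount E′ p × ECount E′ c))
        × (∀ E′ c′ → IsPec E′ → PCount E′ p → ECount E′ c′ → c ≤ c′))

-- Colouring the edges of each component of a pec decomposition F alternately splits F into
-- two disjoint matchings, and conversely the union of two disjoint matchings is a pec
-- decomposition (follow the alternating walk from a vertex). Counting vertices component by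
-- component gives n = |F| + p(F) and n ≤ 2|H| + e(F) for the even-indexed half H of F, while a
-- matching H ⊆ F misses a vertex of every even path, so 2|H| + e(F) ≤ n. Hence n = 2ν + e and
-- λ = n − p. If μ = ν, a pair (H , H′) ∈ Λ with |H| = ν spans a decomposition with p(G) paths
-- and at most n − 2ν = e even paths, so e_p ≤ e. If e = e_p, splitting a decomposition that
-- realises e_p gives a pair in Λ whose first half H has n ≤ 2|H| + e, so ν ≤ |H| ≤ μ.

module Submission where

open import Defs

open import Data.Bool as Bool using (Bool; true; false; not; if_then_else_)
open import Data.Bool.Properties using (not-involutive; not-injective; not-¬; ¬-not)
open import Data.Empty using (⊥; ⊥-elim)
open import Data.Fin as Fin using (Fin; zero; suc; toℕ; inject₁; fromℕ)
open import Data.Fin.Relation.Unary.Top using (view; ‵fromℕ; ‵inject₁)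
import Data.Fin.Properties as Finₚ
open import Data.Fin.Properties using (injective⇒≤; +↔⊎; any?; toℕ-inject₁; toℕ-fromℕ)
open import Data.Fin.Subset using (Subset; _∈_; _∉_; ∣_∣; _∪_; inside; outside) renaming (⊥ to ∅)
import Data.Fin.Subset.Properties as Subₚ
open import Data.Fin.Subset.Properties using (_∈?_; x∈p∪q⁺; x∈p∪q⁻)
open import Data.Nat using (ℕ; zero; suc; _+_; _*_; _∸_; _≤_; _<_; z≤n; s≤s)
open import Data.Nat.Divisibility using (_∣_; _∣?_; divides)
open import Data.Nat.Properties using (+-suc)
import Data.Nat.Properties as ℕ
open import Data.Product using (Σ; ∃; ∃-syntax; _×_; _,_; proj₁; proj₂)
open import Data.Sum as Sum using (_⊎_; inj₁; inj₂)
open import Data.Sum.Function.Propositional using (_⊎-↔_)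
open import Data.Vec using ([]; _∷_; here; there; tabulate)
open import Data.Vec.Properties using (lookup∘tabulate; lookup⇒[]=; []=⇒lookup)
open import Data.Vec.Properties.WithK using ([]=-irrelevant)
open import Function using (id; _∘_; _↔_; _⇔_; Inverse; Injective; Injection; mk↔ₛ′; mk⇔; Equivalence)
open Equivalence using (to; from)
open import Function.Properties.Equivalence using () renaming (sym to ⇔-sym)
open import Function.Properties.Inverse using (↔-sym; ↔-trans; ↔-refl; ↔⇒↣)
open import Relation.Binary.PropositionalEquality
open import Relation.Binary using (tri<; tri≈; tri>)
open import Relation.Nullary using (¬_; ¬?; Dec; yes; no; does)
import Relation.Nullary.Decidable as Dec
open import Relation.Nullary.Decidable using (dec-true; _⊎-dec_; _×-dec_)
open import Relation.Unary using (Decidable)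

_HasSize_ : Set → ℕ → Set
A HasSize k = A ↔ Fin k

injective⇒≤ₛ : ∀ {A B : Set} {a b} → A HasSize a → B HasSize b →
               {f : A → B} → Injective _≡_ _≡_ f → a ≤ b
injective⇒≤ₛ A↔ B↔ {f} inj = injective⇒≤ {f = Inverse.to B↔ ∘ f ∘ Inverse.from A↔}
  (Injection.injective (↔⇒↣ (↔-sym A↔)) ∘ inj ∘ Injection.injective (↔⇒↣ B↔))

⊎-size : ∀ {A B : Set} {a b} → A HasSize a → B HasSize b → (A ⊎ B) HasSize (a + b)
⊎-size A↔ B↔ = ↔-trans (A↔ ⊎-↔ B↔) (↔-sym +↔⊎)

Elem : ∀ {n} → Subset n → Set
Elem {n} S = Σ (Fin n) (_∈ S)

enum : ∀ {n} (S : Subset n) → Fin ∣ S ∣ → Fin n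
enum (inside ∷ S) zero = zero
enum (inside ∷ S) (suc i) = suc (enum S i)
enum (outside ∷ S) i = suc (enum S i)

enum-∈ : ∀ {n} (S : Subset n) i → enum S i ∈ S
enum-∈ (inside ∷ S) zero = here
enum-∈ (inside ∷ S) (suc i) = there (enum-∈ S i)
enum-∈ (outside ∷ S) i = there (enum-∈ S i)

index : ∀ {n} (S : Subset n) {x} → x ∈ S → Fin ∣ S ∣
index (inside ∷ S) here = zero
index (inside ∷ S) (there p) = suc (index S p)
index (outside ∷ S) (there p) = index S p

enum-index : ∀ {n} (S : Subset n) {x} (p : x ∈ S) → enum S (index S p) ≡ x
enum-index (inside ∷ S) here = refl
enum-index (inside ∷ S) (there p) = cong suc (enum-index S p)
enum-index (outside ∷ S) (there p) = cong suc (enum-index S p)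

enum-injective : ∀ {n} (S : Subset n) → Injective _≡_ _≡_ (enum S)
enum-injective (inside ∷ S) {zero} {zero} _ = refl
enum-injective (inside ∷ S) {suc i} {suc j} eq = cong suc (enum-injective S (Finₚ.suc-injective eq))
enum-injective (outside ∷ S) eq = enum-injective S (Finₚ.suc-injective eq)

index-enum : ∀ {n} (S : Subset n) i → index S (enum-∈ S i) ≡ i
index-enum (inside ∷ S) zero = refl
index-enum (inside ∷ S) (suc i) = cong suc (index-enum S i)
index-enum (outside ∷ S) i = index-enum S i

Elem-≡ : ∀ {n} {S : Subset n} {a b : Elem S} → proj₁ a ≡ proj₁ b → a ≡ b
Elem-≡ {a = x , p} {.x , q} refl = cong (x ,_) ([]=-irrelevant p q)

Elem-size : ∀ {n} (S : Subset n) → Elem S HasSize ∣ S ∣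
Elem-size S = mk↔ₛ′ (λ (_ , p) → index S p) (λ i → enum S i , enum-∈ S i)
  (index-enum S) (λ (_ , p) → Elem-≡ (enum-index S p))

<-distinct⇒injective : ∀ {a} {A : Set} (f : Fin a → A) → (∀ {i j} → i Fin.< j → f i ≢ f j) →
                       Injective _≡_ _≡_ f
<-distinct⇒injective f distinct {i} {j} eq with Finₚ.<-cmp i j
... | tri< i<j _ _ = ⊥-elim (distinct i<j eq)
... | tri≈ _ i≡j _ = i≡j
... | tri> _ _ j<i = ⊥-elim (distinct j<i (sym eq))

∷-disjoint⁻ : ∀ {n x y} {p q : Subset n} → (∀ z → z ∈ x ∷ p → z ∉ y ∷ q) → ∀ z → z ∈ p → z ∉ q
∷-disjoint⁻ disj z z∈p z∈q = disj (suc z) (there z∈p) (there z∈q)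

∣p∪q∣≡∣p∣+∣q∣ : ∀ {n} (p q : Subset n) → (∀ x → x ∈ p → x ∉ q) → ∣ p ∪ q ∣ ≡ ∣ p ∣ + ∣ q ∣
∣p∪q∣≡∣p∣+∣q∣ [] [] _ = refl
∣p∪q∣≡∣p∣+∣q∣ (inside ∷ p) (inside ∷ q) disj = ⊥-elim (disj zero here here)
∣p∪q∣≡∣p∣+∣q∣ (inside ∷ p) (outside ∷ q) disj = cong suc (∣p∪q∣≡∣p∣+∣q∣ p q (∷-disjoint⁻ disj))
∣p∪q∣≡∣p∣+∣q∣ (outside ∷ p) (inside ∷ q) disj =
  trans (cong suc (∣p∪q∣≡∣p∣+∣q∣ p q (∷-disjoint⁻ disj))) (sym (+-suc ∣ p ∣ ∣ q ∣))
∣p∪q∣≡∣p∣+∣q∣ (outside ∷ p) (outside ∷ q) disj = ∣p∪q∣≡∣p∣+∣q∣ p q (∷-disjoint⁻ disj)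

module _ {n : ℕ} {P : Fin n → Set} (P? : Decidable P) where

  select : Subset n
  select = tabulate (does ∘ P?)

  ∈-select⁺ : ∀ {x} → P x → x ∈ select
  ∈-select⁺ {x} px = lookup⇒[]= x select (trans (lookup∘tabulate _ x) (dec-true (P? x) px))

  ∈-select⁻ : ∀ {x} → x ∈ select → P x
  ∈-select⁻ {x} x∈ with P? x | trans (sym (lookup∘tabulate (does ∘ P?) x)) ([]=⇒lookup x∈)
  ... | yes px | _ = px

least : ∀ {n} {P : Fin n → Set} → Decidable P → ∃ P → Σ (Fin n) λ i → P i × (∀ j → P j → i Fin.≤ j)
least {suc n} P? p with P? zero
... | yes p₀ = zero , p₀ , λ _ _ → z≤n
least {suc n} P? (zero , p₀) | no ¬p₀ = ⊥-elim (¬p₀ p₀)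
least {suc n} P? (suc j , pⱼ) | no ¬p₀ with least (P? ∘ suc) (j , pⱼ)
... | i , pᵢ , minᵢ = suc i , pᵢ , λ { zero p₀ → ⊥-elim (¬p₀ p₀) ; (suc j) pⱼ → s≤s (minᵢ j pⱼ) }

even : ℕ → Bool
even zero = true
even (suc k) = not (even k)

2∣⇒even : ∀ {k} → 2 ∣ k → even k ≡ true
2∣⇒even (divides q refl) = even-double q
  where
  even-double : ∀ q → even (q * 2) ≡ true
  even-double zero = refl
  even-double (suc q) = trans (not-involutive (even (q * 2))) (even-double q)

even⇒2∣ : ∀ k → even k ≡ true → 2 ∣ k
even⇒2∣ zero _ = divides 0 refl
even⇒2∣ (suc zero) ()
even⇒2∣ (suc (suc k)) e with even⇒2∣ k (trans (sym (not-involutive (even k))) e)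
... | divides q refl = divides (suc q) refl

PathEnd : ℕ → ℕ → Set
PathEnd a j = a ≡ j ⊎ a ≡ suc j

CycleEnd : ℕ → ℕ → ℕ → Set
CycleEnd l a j = PathEnd a j ⊎ (j ≡ l × a ≡ 0)

path-ends-disjoint : ∀ {a j j′ b} → even j ≡ b → even j′ ≡ b → j ≢ j′ →
                     PathEnd a j → PathEnd a j′ → ⊥
path-ends-disjoint ej ej′ j≢j′ (inj₁ refl) (inj₁ refl) = j≢j′ refl
path-ends-disjoint ej ej′ j≢j′ (inj₁ refl) (inj₂ refl) = not-¬ refl (trans ej′ (sym ej))
path-ends-disjoint ej ej′ j≢j′ (inj₂ refl) (inj₁ refl) = not-¬ refl (trans ej (sym ej′))
path-ends-disjoint ej ej′ j≢j′ (inj₂ refl) (inj₂ refl) = j≢j′ refl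

cycle-ends-disjoint : ∀ {l a j j′ b} → even (suc l) ≡ true → even j ≡ b → even j′ ≡ b → j ≢ j′ →
                      CycleEnd l a j → CycleEnd l a j′ → ⊥
cycle-ends-disjoint el ej ej′ j≢j′ (inj₁ p) (inj₁ p′) = path-ends-disjoint ej ej′ j≢j′ p p′
cycle-ends-disjoint el ej ej′ j≢j′ (inj₂ (refl , refl)) (inj₁ (inj₁ refl)) =
  not-¬ refl (trans (trans ej (sym ej′)) (sym el))
cycle-ends-disjoint el ej ej′ j≢j′ (inj₁ (inj₁ refl)) (inj₂ (refl , refl)) =
  not-¬ refl (trans (trans ej′ (sym ej)) (sym el))
cycle-ends-disjoint el ej ej′ j≢j′ (inj₂ (refl , _)) (inj₂ (refl , _)) = j≢j′ refl

module GraphFacts {n m : ℕ} (G : Graph n m) where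
  open Graph G

  Links-sym : ∀ {e u w} → Links G e u w → Links G e w u
  Links-sym (inj₁ (s , t)) = inj₂ (s , t)
  Links-sym (inj₂ (s , t)) = inj₁ (s , t)

  Links⇒Incidentˡ : ∀ {e u w} → Links G e u w → Incident G e u
  Links⇒Incidentˡ (inj₁ (s , _)) = inj₁ s
  Links⇒Incidentˡ (inj₂ (_ , t)) = inj₂ t

  Links⇒Incidentʳ : ∀ {e u w} → Links G e u w → Incident G e w
  Links⇒Incidentʳ = Links⇒Incidentˡ ∘ Links-sym

  Incident⇒Links : ∀ {e u} → Incident G e u → ∃[ w ] Links G e u w
  Incident⇒Links {e} (inj₁ s) = tgt e , inj₁ (s , refl)
  Incident⇒Links {e} (inj₂ t) = src e , inj₂ (refl , t)

  Incident? : ∀ e u → Dec (Incident G e u)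
  Incident? e u = (src e Fin.≟ u) ⊎-dec (tgt e Fin.≟ u)

  Links-ends : ∀ {e u w v} → Links G e u w → Incident G e v → v ≡ u ⊎ v ≡ w
  Links-ends (inj₁ (s , t)) (inj₁ s′) = inj₁ (trans (sym s′) s)
  Links-ends (inj₁ (s , t)) (inj₂ t′) = inj₂ (trans (sym t′) t)
  Links-ends (inj₂ (s , t)) (inj₁ s′) = inj₂ (trans (sym s′) s)
  Links-ends (inj₂ (s , t)) (inj₂ t′) = inj₁ (trans (sym t′) t)

  Links-irreflexive : ∀ {e u} → ¬ Links G e u u
  Links-irreflexive (inj₁ (s , t)) = loopless _ (trans s (sym t))
  Links-irreflexive (inj₂ (s , t)) = loopless _ (trans s (sym t))

  Links-functional : ∀ {e u w w′} → Links G e u w → Links G e u w′ → w ≡ w′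
  Links-functional (inj₁ (_ , t)) (inj₁ (_ , t′)) = trans (sym t) t′
  Links-functional (inj₁ (s , t)) (inj₂ (s′ , t′)) = ⊥-elim (loopless _ (trans s (sym t′)))
  Links-functional (inj₂ (s , t)) (inj₁ (s′ , t′)) = ⊥-elim (loopless _ (trans s′ (sym t)))
  Links-functional (inj₂ (s , _)) (inj₂ (s′ , _)) = trans (sym s) s′

  Links-unique : ∀ {e u w u′ w′} → Links G e u w → Links G e u′ w′ →
                 (u ≡ u′ × w ≡ w′) ⊎ (u ≡ w′ × w ≡ u′)
  Links-unique (inj₁ (s , t)) (inj₁ (s′ , t′)) = inj₁ (trans (sym s) s′ , trans (sym t) t′)
  Links-unique (inj₁ (s , t)) (inj₂ (s′ , t′)) = inj₂ (trans (sym s) s′ , trans (sym t) t′)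
  Links-unique (inj₂ (s , t)) (inj₁ (s′ , t′)) = inj₂ (trans (sym t) t′ , trans (sym s) s′)
  Links-unique (inj₂ (s , t)) (inj₂ (s′ , t′)) = inj₁ (trans (sym t) t′ , trans (sym s) s′)

  matching-unique : ∀ {H e f v} → IsMatching G H → e ∈ H → f ∈ H →
                    Incident G e v → Incident G f v → e ≡ f
  matching-unique {e = e} {f} H-match e∈H f∈H e∋v f∋v with e Fin.≟ f
  ... | yes e≡f = e≡f
  ... | no e≢f = ⊥-elim (H-match e f e∈H f∈H e≢f _ e∋v f∋v)

module Components {n m : ℕ} (G : Graph n m) (F : Subset m) where
  open GraphFacts G

  Reach-trans : ∀ {u v w} → Reach G F u v → Reach G F v w → Reach G F u w
  Reach-trans p here = p
  Reach-trans p (step e e∈F l q) = step e e∈F l (Reach-trans p q)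

  Reach-edge : ∀ {e u w} → e ∈ F → Links G e u w → Reach G F u w
  Reach-edge e∈F l = step _ e∈F l here

  Reach-sym : ∀ {u v} → Reach G F u v → Reach G F v u
  Reach-sym here = here
  Reach-sym (step e e∈F l q) = Reach-trans (Reach-edge e∈F (Links-sym l)) (Reach-sym q)

  Reach-incident : ∀ {e u w} → e ∈ F → Incident G e u → Incident G e w → Reach G F u w
  Reach-incident e∈F (inj₁ refl) (inj₁ refl) = here
  Reach-incident e∈F (inj₁ refl) (inj₂ refl) = Reach-edge e∈F (inj₁ (refl , refl))
  Reach-incident e∈F (inj₂ refl) (inj₁ refl) = Reach-edge e∈F (inj₂ (refl , refl))
  Reach-incident e∈F (inj₂ refl) (inj₂ refl) = here

  Spans : ∀ {a} → Fin n → (Fin a → Fin n) → Set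
  Spans v x = ∀ u → Reach G F v u ⇔ (∃[ i ] x i ≡ u)

  Spans-move : ∀ {a v v′} {x : Fin a → Fin n} → Spans v x → Reach G F v v′ → Spans v′ x
  Spans-move x-spans v↝v′ u = mk⇔ (to (x-spans u) ∘ Reach-trans v↝v′)
                                  (Reach-trans (Reach-sym v↝v′) ∘ from (x-spans u))

  Spans? : ∀ {a v} {x : Fin a → Fin n} → Spans v x → ∀ u → Dec (Reach G F v u)
  Spans? {x = x} x-spans u = Dec.map (⇔-sym (x-spans u)) (any? (λ i → x i Fin.≟ u))

  Spans-≤ : ∀ {a b v} {x : Fin a → Fin n} {y : Fin b → Fin n} →
            Injective _≡_ _≡_ x → Spans v x → Spans v y → a ≤ b
  Spans-≤ {x = x} {y} x-inj x-spans y-spans = injective⇒≤ {f = position} λ {i} {j} eq →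
    x-inj (trans (sym (position-correct i)) (trans (cong y eq) (position-correct j)))
    where
    found : ∀ i → ∃[ j ] y j ≡ x i
    found i = to (y-spans (x i)) (from (x-spans (x i)) (i , refl))
    position = proj₁ ∘ found
    position-correct = proj₂ ∘ found

  IsPathComp-move : ∀ {v v′ k} → IsPathComp G F v k → Reach G F v v′ → IsPathComp G F v′ k
  IsPathComp-move (x , x-inj , x-spans , ed , ed-inj , ed-links , ed-covers) v↝v′ =
    x , x-inj , Spans-move x-spans v↝v′ , ed , ed-inj , ed-links ,
    λ e e∈F (u , v′↝u , e∋u) → ed-covers e e∈F (u , Reach-trans v↝v′ v′↝u , e∋u)

  PathComp-move : ∀ {v v′} → PathComp G F v → Reach G F v v′ → PathComp G F v′
  PathComp-move (k , p) v↝v′ = k , IsPathComp-move p v↝v′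

  EvenPathComp-move : ∀ {v v′} → EvenPathComp G F v → Reach G F v v′ → EvenPathComp G F v′
  EvenPathComp-move (k , p , 2∣k) v↝v′ = k , IsPathComp-move p v↝v′ , 2∣k

  PecComp : Fin n → Set
  PecComp v = PathComp G F v ⊎ EvenCycleComp G F v

  PecComp-Reach? : ∀ {v} → PecComp v → ∀ u → Dec (Reach G F v u)
  PecComp-Reach? (inj₁ (_ , _ , _ , x-spans , _)) = Spans? x-spans
  PecComp-Reach? (inj₂ (_ , (_ , _ , y-spans , _) , _)) = Spans? y-spans

  IsPathComp-length-unique : ∀ {v k k′} → IsPathComp G F v k → IsPathComp G F v k′ → k ≡ k′
  IsPathComp-length-unique (x , x-inj , x-spans , _) (x′ , x′-inj , x′-spans , _) =
    ℕ.suc-injective (ℕ.≤-antisym (Spans-≤ x-inj x-spans x′-spans) (Spans-≤ x′-inj x′-spans x-spans))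

  cycle-edge-incident : ∀ {l} {y : Fin (suc l) → Fin n} {ed : Fin (suc l) → Fin m} →
    (∀ (i : Fin l) → Links G (ed (inject₁ i)) (y (inject₁ i)) (y (suc i))) →
    Links G (ed (fromℕ l)) (y (fromℕ l)) (y zero) →
    ∀ i → Incident G (ed i) (y i)
  cycle-edge-incident ed-links ed-closes i with view i
  ... | ‵fromℕ = Links⇒Incidentˡ ed-closes
  ... | ‵inject₁ j = Links⇒Incidentˡ (ed-links j)

  path-not-cycle : ∀ {v k l} → IsPathComp G F v k → IsCycleComp G F v l → ⊥
  path-not-cycle {k = k} (x , x-inj , x-spans , ed , ed-inj , _ , ed-covers)
                         (y , _ , y-spans , ed′ , ed′-inj , ed′∈F , ed′-links , ed′-closes , _) =
    ℕ.<-irrefl refl (ℕ.<-≤-trans (Spans-≤ x-inj x-spans y-spans) edges≤k)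
    where
    -- every edge of the cycle is an edge of the path: l + 1 ≤ k < k + 1 ≤ l + 1
    covered : ∀ i → ∃[ j ] ed j ≡ ed′ i
    covered i = ed-covers (ed′ i) (ed′∈F i)
      (y i , from (y-spans (y i)) (i , refl) , cycle-edge-incident ed′-links ed′-closes i)
    edges≤k = injective⇒≤ {f = proj₁ ∘ covered} λ {i} {j} eq →
      ed′-inj (trans (sym (proj₂ (covered i))) (trans (cong ed eq) (proj₂ (covered j))))

  path-edge-ends : ∀ {k} {x : Fin (suc k) → Fin n} {ed : Fin k → Fin m} → Injective _≡_ _≡_ x →
    (∀ j → Links G (ed j) (x (inject₁ j)) (x (suc j))) →
    ∀ j a → Incident G (ed j) (x a) → PathEnd (toℕ a) (toℕ j)
  path-edge-ends x-inj ed-links j a e∋xa with Links-ends (ed-links j) e∋xa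
  ... | inj₁ eq = inj₁ (trans (cong toℕ (x-inj eq)) (toℕ-inject₁ j))
  ... | inj₂ eq = inj₂ (cong toℕ (x-inj eq))

  cycle-edge-ends : ∀ {l} {y : Fin (suc l) → Fin n} {ed : Fin (suc l) → Fin m} → Injective _≡_ _≡_ y →
    (∀ (i : Fin l) → Links G (ed (inject₁ i)) (y (inject₁ i)) (y (suc i))) →
    Links G (ed (fromℕ l)) (y (fromℕ l)) (y zero) →
    ∀ j a → Incident G (ed j) (y a) → CycleEnd l (toℕ a) (toℕ j)
  cycle-edge-ends y-inj ed-links ed-closes j a e∋ya with view j
  ... | ‵inject₁ i rewrite toℕ-inject₁ i = inj₁ (path-edge-ends y-inj ed-links i a e∋ya)
  ... | ‵fromℕ with Links-ends ed-closes e∋ya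
  ...   | inj₁ eq = inj₁ (inj₁ (cong toℕ (y-inj eq)))
  ...   | inj₂ eq = inj₂ (toℕ-fromℕ _ , cong toℕ (y-inj eq))

module Pec {n m : ℕ} (G : Graph n m) (F : Subset m) (pec : IsPec G F) where
  open GraphFacts G
  open Components G F

  Reach? : ∀ v u → Dec (Reach G F v u)
  Reach? v = PecComp-Reach? (pec v)

  -- The least vertex of a component names it canonically.
  root : Fin n → Fin n
  root u = proj₁ (least (Reach? u) (u , here))

  Reach-root : ∀ u → Reach G F u (root u)
  Reach-root u = proj₁ (proj₂ (least (Reach? u) (u , here)))

  root-least : ∀ u w → Reach G F u w → root u Fin.≤ w
  root-least u = proj₂ (proj₂ (least (Reach? u) (u , here)))

  root-cong : ∀ {u u′} → Reach G F u u′ → root u ≡ root u′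
  root-cong {u} {u′} u↝u′ = Finₚ.≤-antisym
    (root-least u (root u′) (Reach-trans u↝u′ (Reach-root u′)))
    (root-least u′ (root u) (Reach-trans (Reach-sym u↝u′) (Reach-root u)))

  root-idempotent : ∀ u → root (root u) ≡ root u
  root-idempotent u = sym (root-cong (Reach-root u))

  PathComp? : ∀ v → Dec (PathComp G F v)
  PathComp? v with pec v
  ... | inj₁ p = yes p
  ... | inj₂ (_ , c , _) = no λ (_ , p) → path-not-cycle p c

  EvenPathComp? : ∀ v → Dec (EvenPathComp G F v)
  EvenPathComp? v with pec v
  ... | inj₂ (_ , c , _) = no λ (_ , p , _) → path-not-cycle p c
  ... | inj₁ (k , p) with 2 ∣? k
  ...   | yes 2∣k = yes (k , p , 2∣k)
  ...   | no 2∤k = no λ (_ , p′ , 2∣k′) → 2∤k (subst (2 ∣_) (IsPathComp-length-unique p′ p) 2∣k′)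

  count : (P : Fin n → Set) → Decidable P → (∀ {v u} → P v → Reach G F v u → P u) →
          ∃[ c ] CompCount G F P c
  count P P? P-move = ∣ roots ∣ , enum roots , distinct , satisfies , covers
    where
    IsRoot : Fin n → Set
    IsRoot v = root v ≡ v × P v
    IsRoot? : Decidable IsRoot
    IsRoot? v = (root v Fin.≟ v) ×-dec P? v
    roots = select IsRoot?
    root-enum : ∀ i → root (enum roots i) ≡ enum roots i
    root-enum i = proj₁ (∈-select⁻ IsRoot? (enum-∈ roots i))
    distinct : ∀ i j → Reach G F (enum roots i) (enum roots j) → i ≡ j
    distinct i j i↝j = enum-injective roots (trans (sym (root-enum i)) (trans (root-cong i↝j) (root-enum j)))
    satisfies : ∀ i → P (enum roots i)
    satisfies i = proj₂ (∈-select⁻ IsRoot? (enum-∈ roots i))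
    covers : ∀ v → P v → ∃[ i ] Reach G F (enum roots i) v
    covers v pv = index roots root∈ ,
                  subst (λ r → Reach G F r v) (sym (enum-index roots root∈)) (Reach-sym (Reach-root v))
      where
      root∈ : root v ∈ roots
      root∈ = ∈-select⁺ IsRoot? (root-idempotent v , P-move pv (Reach-root v))

  pathCount : ∃[ c ] PCount G F c
  pathCount = count (PathComp G F) PathComp? PathComp-move

  evenPathCount : ∃[ c ] ECount G F c
  evenPathCount = count (EvenPathComp G F) EvenPathComp? EvenPathComp-move

  -- Maps computed in the canonical description of the component containing the anchor.
  module _ {A B : Set} (anchor : A → Fin n) (f : ∀ r a → Reach G F r (anchor a) → B) where

    atRoot : A → B
    atRoot a = f (root (anchor a)) a (Reach-sym (Reach-root (anchor a)))

    atRoot-injective : (∀ r {a a′} p p′ → f r a p ≡ f r a′ p′ → a ≡ a′) →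
                       (∀ {a a′} → atRoot a ≡ atRoot a′ → Reach G F (anchor a) (anchor a′)) →
                       Injective _≡_ _≡_ atRoot
    atRoot-injective f-injective same-component {a} {a′} eq =
      within (root-cong (same-component eq)) _ _ eq
      where
      within : ∀ {r r′} → r ≡ r′ → (p : Reach G F r (anchor a)) (p′ : Reach G F r′ (anchor a′)) →
               f r a p ≡ f r′ a′ p′ → a ≡ a′
      within refl = f-injective _

module VertexCount {n m : ℕ} (G : Graph n m) (F : Subset m) (pec : IsPec G F)
                   {c : ℕ} (paths : PCount G F c) where
  open GraphFacts G
  open Components G F
  open Pec G F pec

  private
    rep = proj₁ paths
    rep-distinct = proj₁ (proj₂ paths)
    rep-path = proj₁ (proj₂ (proj₂ paths))
    rep-covers = proj₂ (proj₂ (proj₂ paths))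

  -- Orient every component; each vertex is then matched with the F-edge leaving it,
  -- or, at the terminal vertex of a path, with that path.
  Label : Set
  Label = Elem F ⊎ Fin c

  data PathLeaves {k} (x : Fin (suc k) → Fin n) (ed : Fin k → Fin m) (u : Fin n) : Label → Set where
    edge : ∀ j {e} → ed j ≡ proj₁ e → x (inject₁ j) ≡ u → PathLeaves x ed u (inj₁ e)
    end  : ∀ i → x (fromℕ k) ≡ u → Reach G F (rep i) u → PathLeaves x ed u (inj₂ i)

  data CycleLeaves {l} (y : Fin (suc l) → Fin n) (ed : Fin (suc l) → Fin m) (u : Fin n) : Label → Set where
    edge : ∀ j {e} → ed j ≡ proj₁ e → y j ≡ u → CycleLeaves y ed u (inj₁ e)

  Leaves : ∀ {r} → PecComp r → Fin n → Label → Set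
  Leaves (inj₁ (k , x , _ , _ , ed , _)) = PathLeaves x ed
  Leaves (inj₂ (l , (y , _ , _ , ed , _) , _)) = CycleLeaves y ed

  Leaves-injective : ∀ {r} (d : PecComp r) {u u′ ℓ} → Leaves d u ℓ → Leaves d u′ ℓ → u ≡ u′
  Leaves-injective (inj₁ (_ , x , _ , _ , _ , ed-inj , _)) (edge j eq refl) (edge j′ eq′ refl) =
    cong (x ∘ inject₁) (ed-inj (trans eq (sym eq′)))
  Leaves-injective (inj₁ _) (end i refl _) (end .i refl _) = refl
  Leaves-injective (inj₂ (_ , (y , _ , _ , _ , ed-inj , _) , _)) (edge j eq refl) (edge j′ eq′ refl) =
    cong y (ed-inj (trans eq (sym eq′)))

  Leaves-functional : ∀ {r} (d : PecComp r) {u ℓ ℓ′} → Leaves d u ℓ → Leaves d u ℓ′ → ℓ ≡ ℓ′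
  Leaves-functional (inj₁ (_ , x , x-inj , _)) (edge j eq refl) (edge j′ eq′ xj≡xj′) =
    cong inj₁ (Elem-≡ (trans (sym eq) (trans (cong _ (Finₚ.inject₁-injective (x-inj (sym xj≡xj′)))) eq′)))
  Leaves-functional (inj₁ (_ , x , x-inj , _)) (edge j _ refl) (end _ xk≡xj _) =
    ⊥-elim (Finₚ.fromℕ≢inject₁ (x-inj xk≡xj))
  Leaves-functional (inj₁ (_ , x , x-inj , _)) (end _ refl _) (edge j _ xj≡xk) =
    ⊥-elim (Finₚ.fromℕ≢inject₁ (x-inj (sym xj≡xk)))
  Leaves-functional (inj₁ _) (end i _ i↝u) (end i′ _ i′↝u) =
    cong inj₂ (rep-distinct i i′ (Reach-trans i↝u (Reach-sym i′↝u)))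
  Leaves-functional (inj₂ (_ , (y , y-inj , _ , ed , _) , _)) (edge j eq refl) (edge j′ eq′ yj≡yj′) =
    cong inj₁ (Elem-≡ (trans (sym eq) (trans (cong ed (y-inj (sym yj≡yj′))) eq′)))

  leaving : ∀ {r u} (d : PecComp r) → Reach G F r u → ∃[ ℓ ] Leaves d u ℓ
  leaving (inj₁ (k , p@(x , _ , x-spans , ed , _ , ed-links , _))) r↝u with to (x-spans _) r↝u
  ... | a , refl with view a
  ...   | ‵inject₁ j = inj₁ (ed j , proj₁ (ed-links j)) , edge j refl refl
  ...   | ‵fromℕ = let (i , i↝r) = rep-covers _ (k , p) in inj₂ i , end i refl (Reach-trans i↝r r↝u)
  leaving (inj₂ (_ , (y , _ , y-spans , ed , _ , ed∈F , _) , _)) r↝u with to (y-spans _) r↝u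
  ... | a , refl = inj₁ (ed a , ed∈F a) , edge a refl refl

  Anchored : Fin n → Label → Set
  Anchored u (inj₁ (e , _)) = Incident G e u
  Anchored u (inj₂ i) = Reach G F (rep i) u

  Leaves-anchored : ∀ {r} (d : PecComp r) {u ℓ} → Leaves d u ℓ → Anchored u ℓ
  Leaves-anchored (inj₁ (_ , _ , _ , _ , _ , _ , ed-links , _)) (edge j refl refl) =
    Links⇒Incidentˡ (proj₂ (ed-links j))
  Leaves-anchored (inj₁ _) (end _ _ i↝u) = i↝u
  Leaves-anchored (inj₂ (_ , (_ , _ , _ , _ , _ , _ , ed-links , ed-closes , _) , _)) (edge j refl refl) =
    cycle-edge-incident ed-links ed-closes j

  Anchored-Reach : ∀ {u u′} ℓ → Anchored u ℓ → Anchored u′ ℓ → Reach G F u u′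
  Anchored-Reach (inj₁ (_ , e∈F)) = Reach-incident e∈F
  Anchored-Reach (inj₂ _) i↝u i↝u′ = Reach-trans (Reach-sym i↝u) i↝u′

  base : Label → Fin n
  base (inj₁ (e , _)) = Graph.src G e
  base (inj₂ i) = rep i

  left : ∀ {r} (d : PecComp r) ℓ → Reach G F r (base ℓ) → ∃[ u ] Leaves d u ℓ × Reach G F r u
  left (inj₁ (_ , x , _ , x-spans , ed , _ , _ , ed-covers)) (inj₁ (e , e∈F)) r↝e =
    let (j , ed-j≡e) = ed-covers e e∈F (_ , r↝e , inj₁ refl)
    in x (inject₁ j) , edge j ed-j≡e refl , from (x-spans _) (inject₁ j , refl)
  left (inj₁ (k , x , _ , x-spans , _)) (inj₂ i) r↝i =
    let r↝end = from (x-spans _) (fromℕ k , refl)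
    in x (fromℕ k) , end i refl (Reach-trans (Reach-sym r↝i) r↝end) , r↝end
  left (inj₂ (_ , (y , _ , y-spans , ed , _ , _ , _ , _ , ed-covers) , _)) (inj₁ (e , e∈F)) r↝e =
    let (j , ed-j≡e) = ed-covers e e∈F (_ , r↝e , inj₁ refl)
    in y j , edge j ed-j≡e refl , from (y-spans _) (j , refl)
  left (inj₂ (_ , c , _)) (inj₂ i) r↝i =
    ⊥-elim (path-not-cycle (proj₂ (PathComp-move (rep-path i) (Reach-sym r↝i))) c)

  order≤ : n ≤ ∣ F ∣ + c
  order≤ = injective⇒≤ₛ ↔-refl (⊎-size (Elem-size F) ↔-refl) (atRoot-injective id f f-injective same-component)
    where
    f : ∀ r u → Reach G F r u → Label
    f r u r↝u = proj₁ (leaving (pec r) r↝u)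
    f-injective : ∀ r {u u′} p p′ → f r u p ≡ f r u′ p′ → u ≡ u′
    f-injective r p p′ eq = Leaves-injective (pec r) (proj₂ (leaving (pec r) p))
      (subst (Leaves (pec r) _) (sym eq) (proj₂ (leaving (pec r) p′)))
    same-component : ∀ {u u′} → atRoot id f u ≡ atRoot id f u′ → Reach G F u u′
    same-component {u} {u′} eq = Anchored-Reach (atRoot id f u)
      (Leaves-anchored _ (proj₂ (leaving (pec (root u)) _)))
      (subst (Anchored u′) (sym eq) (Leaves-anchored _ (proj₂ (leaving (pec (root u′)) _))))

  ≤order : ∣ F ∣ + c ≤ n
  ≤order = injective⇒≤ₛ (⊎-size (Elem-size F) ↔-refl) ↔-refl (atRoot-injective base f f-injective same-component)
    where
    f : ∀ r ℓ → Reach G F r (base ℓ) → Fin n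
    f r ℓ r↝ℓ = proj₁ (left (pec r) ℓ r↝ℓ)
    f-injective : ∀ r {ℓ ℓ′} p p′ → f r ℓ p ≡ f r ℓ′ p′ → ℓ ≡ ℓ′
    f-injective r {ℓ} {ℓ′} p p′ eq = Leaves-functional (pec r) (proj₁ (proj₂ (left (pec r) ℓ p)))
      (subst (λ u → Leaves (pec r) u ℓ′) (sym eq) (proj₁ (proj₂ (left (pec r) ℓ′ p′))))
    reach : ∀ ℓ → Reach G F (base ℓ) (atRoot base f ℓ)
    reach ℓ = Reach-trans (Reach-root (base ℓ)) (proj₂ (proj₂ (left (pec _) ℓ _)))
    same-component : ∀ {ℓ ℓ′} → atRoot base f ℓ ≡ atRoot base f ℓ′ → Reach G F (base ℓ) (base ℓ′)
    same-component {ℓ} {ℓ′} eq =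
      Reach-trans (reach ℓ) (subst (λ u → Reach G F u _) (sym eq) (Reach-sym (reach ℓ′)))

  order≡size+paths : n ≡ ∣ F ∣ + c
  order≡size+paths = ℕ.≤-antisym order≤ ≤order

module ParitySplit {n m : ℕ} (G : Graph n m) (F : Subset m) (pec : IsPec G F) where
  open GraphFacts G
  open Components G F
  open Pec G F pec

  IndexParity : ∀ {k} → (Fin k → Fin m) → Bool → Fin m → Set
  IndexParity ed b e = ∃[ j ] ed j ≡ e × even (toℕ j) ≡ b

  IndexParity? : ∀ {k} (ed : Fin k → Fin m) b e → Dec (IndexParity ed b e)
  IndexParity? ed b e = any? λ j → (ed j Fin.≟ e) ×-dec (even (toℕ j) Bool.≟ b)

  IndexParity-split : ∀ {k} {ed : Fin k → Fin m} {e} → ∃[ j ] ed j ≡ e →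
                      IndexParity ed true e ⊎ IndexParity ed false e
  IndexParity-split (j , eq) with even (toℕ j) in parity
  ... | true = inj₁ (j , eq , parity)
  ... | false = inj₂ (j , eq , parity)

  IndexParity-unique : ∀ {k} {ed : Fin k → Fin m} {e} → Injective _≡_ _≡_ ed →
                       IndexParity ed true e → IndexParity ed false e → ⊥
  IndexParity-unique ed-inj (j , eq , even-j) (j′ , eq′ , odd-j′) with ed-inj (trans eq (sym eq′))
  ... | refl with () ← trans (sym even-j) odd-j′

  Class : ∀ {r} → PecComp r → Bool → Fin m → Set
  Class (inj₁ (_ , _ , _ , _ , ed , _)) = IndexParity ed
  Class (inj₂ (_ , (_ , _ , _ , ed , _) , _)) = IndexParity ed

  Class? : ∀ {r} (d : PecComp r) b e → Dec (Class d b e)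
  Class? (inj₁ (_ , _ , _ , _ , ed , _)) = IndexParity? ed
  Class? (inj₂ (_ , (_ , _ , _ , ed , _) , _)) = IndexParity? ed

  Class-split : ∀ {r e} (d : PecComp r) → e ∈ F → Reach G F r (Graph.src G e) → Class d true e ⊎ Class d false e
  Class-split (inj₁ (_ , _ , _ , _ , _ , _ , _ , ed-covers)) e∈F r↝e =
    IndexParity-split (ed-covers _ e∈F (_ , r↝e , inj₁ refl))
  Class-split (inj₂ (_ , (_ , _ , _ , _ , _ , _ , _ , _ , ed-covers) , _)) e∈F r↝e =
    IndexParity-split (ed-covers _ e∈F (_ , r↝e , inj₁ refl))

  Class-unique : ∀ {r e} (d : PecComp r) → Class d true e → Class d false e → ⊥
  Class-unique (inj₁ (_ , _ , _ , _ , _ , ed-inj , _)) = IndexParity-unique ed-inj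
  Class-unique (inj₂ (_ , (_ , _ , _ , _ , ed-inj , _) , _)) = IndexParity-unique ed-inj

  Class-matching : ∀ {r v e f} (d : PecComp r) b → e ≢ f → Class d b e → Class d b f →
                   Reach G F r v → Incident G e v → Incident G f v → ⊥
  Class-matching (inj₁ (_ , x , x-inj , x-spans , ed , _ , ed-links , _)) b e≢f
                 (j , refl , parity-j) (j′ , refl , parity-j′) r↝v e∋v f∋v with to (x-spans _) r↝v
  ... | a , refl = path-ends-disjoint parity-j parity-j′ (e≢f ∘ cong ed ∘ Finₚ.toℕ-injective)
    (path-edge-ends x-inj (proj₂ ∘ ed-links) j a e∋v) (path-edge-ends x-inj (proj₂ ∘ ed-links) j′ a f∋v)
  Class-matching (inj₂ (_ , (y , y-inj , y-spans , ed , _ , _ , ed-links , ed-closes , _) , 2∣l+1)) b e≢f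
                 (j , refl , parity-j) (j′ , refl , parity-j′) r↝v e∋v f∋v with to (y-spans _) r↝v
  ... | a , refl = cycle-ends-disjoint (2∣⇒even 2∣l+1) parity-j parity-j′ (e≢f ∘ cong ed ∘ Finₚ.toℕ-injective)
    (cycle-edge-ends y-inj ed-links ed-closes j a e∋v) (cycle-edge-ends y-inj ed-links ed-closes j′ a f∋v)

  InHalf : Bool → Fin m → Set
  InHalf b e = e ∈ F × Class (pec (root (Graph.src G e))) b e

  InHalf? : ∀ b → Decidable (InHalf b)
  InHalf? b e = (e ∈? F) ×-dec Class? (pec (root (Graph.src G e))) b e

  half : Bool → Subset m
  half b = select (InHalf? b)

  half⊆F : ∀ {b e} → e ∈ half b → e ∈ F
  half⊆F {b} e∈ = proj₁ (∈-select⁻ (InHalf? b) e∈)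

  Class-edge : ∀ {r e b} (d : PecComp r) → Class d b e → e ∈ F × Reach G F r (Graph.src G e)
  Class-edge (inj₁ (_ , x , _ , x-spans , ed , _ , ed-links , _)) (j , refl , _) =
    proj₁ (ed-links j) ,
    Reach-trans (from (x-spans _) (inject₁ j , refl))
                (Reach-incident (proj₁ (ed-links j)) (Links⇒Incidentˡ (proj₂ (ed-links j))) (inj₁ refl))
  Class-edge (inj₂ (_ , (y , _ , y-spans , ed , _ , ed∈F , ed-links , ed-closes , _) , _)) (j , refl , _) =
    ed∈F j ,
    Reach-trans (from (y-spans _) (j , refl))
                (Reach-incident (ed∈F j) (cycle-edge-incident ed-links ed-closes j) (inj₁ refl))

  Class⇒half : ∀ r {e} b → Class (pec (root r)) b e → e ∈ half b
  Class⇒half r b class =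
    let (e∈F , root↝e) = Class-edge (pec (root r)) class in
    ∈-select⁺ (InHalf? b)
      (e∈F , subst (λ r′ → Class (pec r′) b _) (trans (sym (root-idempotent r)) (root-cong root↝e)) class)

  half-class : ∀ {b e v} → e ∈ half b → Incident G e v → Class (pec (root v)) b e
  half-class {b} e∈ e∋v = let (e∈F , class) = ∈-select⁻ (InHalf? b) e∈ in
    subst (λ r → Class (pec r) _ _) (root-cong (Reach-incident e∈F (inj₁ refl) e∋v)) class

  half-matching : ∀ b → IsMatching G (half b)
  half-matching b e f e∈ f∈ e≢f v e∋v f∋v =
    Class-matching (pec (root v)) b e≢f (half-class e∈ e∋v) (half-class f∈ f∋v) (Reach-sym (Reach-root v)) e∋v f∋v

  halves-disjoint : EdgeDisjoint G (half true) (half false)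
  halves-disjoint e e∈₁ e∈₂ =
    Class-unique (pec (root _)) (half-class e∈₁ (inj₁ refl)) (half-class e∈₂ (inj₁ refl))

  halves-cover : ∀ {e} → e ∈ F → e ∈ half true ⊎ e ∈ half false
  halves-cover e∈F = Sum.map (Class⇒half _ true) (Class⇒half _ false)
    (Class-split (pec (root _)) e∈F (Reach-sym (Reach-root _)))

  ∣F∣≡∣halves∣ : ∣ F ∣ ≡ ∣ half true ∣ + ∣ half false ∣
  ∣F∣≡∣halves∣ = begin
    ∣ F ∣                         ≡⟨ cong ∣_∣ F≡halves ⟩
    ∣ half true ∪ half false ∣    ≡⟨ ∣p∪q∣≡∣p∣+∣q∣ (half true) (half false) halves-disjoint ⟩
    ∣ half true ∣ + ∣ half false ∣ ∎
    where
    open ≡-Reasoning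
    F≡halves : F ≡ half true ∪ half false
    F≡halves = Subₚ.⊆-antisym (x∈p∪q⁺ ∘ halves-cover)
      λ {e} e∈ → Sum.[ half⊆F , half⊆F ] (x∈p∪q⁻ (half true) (half false) e∈)

module EvenHalfCover {n m : ℕ} (G : Graph n m) (F : Subset m) (pec : IsPec G F)
                     {e : ℕ} (evenPaths : ECount G F e) where
  open GraphFacts G
  open Components G F
  open Pec G F pec
  open ParitySplit G F pec

  private
    H = half true
    rep = proj₁ evenPaths
    rep-covers = proj₂ (proj₂ (proj₂ evenPaths))

  -- The even-indexed edges cover every vertex except the terminal vertex of each even path.
  Label : Set
  Label = Elem H ⊎ (Elem H ⊎ Fin e)

  data PathCovers {k} (x : Fin (suc k) → Fin n) (ed : Fin k → Fin m) (u : Fin n) : Label → Set where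
    tail : ∀ j {h} → ed j ≡ proj₁ h → x (inject₁ j) ≡ u → PathCovers x ed u (inj₁ h)
    head : ∀ j {h} → ed j ≡ proj₁ h → x (suc j) ≡ u → PathCovers x ed u (inj₂ (inj₁ h))
    end  : ∀ i → x (fromℕ k) ≡ u → Reach G F (rep i) u → PathCovers x ed u (inj₂ (inj₂ i))

  data CycleCovers {l} (y : Fin (suc l) → Fin n) (ed : Fin (suc l) → Fin m) (u : Fin n) : Label → Set where
    tail : ∀ j {h} → ed j ≡ proj₁ h → y j ≡ u → CycleCovers y ed u (inj₁ h)
    head : ∀ j {h} → ed (inject₁ j) ≡ proj₁ h → y (suc j) ≡ u → CycleCovers y ed u (inj₂ (inj₁ h))

  Covers : ∀ {r} → PecComp r → Fin n → Label → Set
  Covers (inj₁ (k , x , _ , _ , ed , _)) = PathCovers x ed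
  Covers (inj₂ (l , (y , _ , _ , ed , _) , _)) = CycleCovers y ed

  Covers-injective : ∀ {r} (d : PecComp r) {u u′ ℓ} → Covers d u ℓ → Covers d u′ ℓ → u ≡ u′
  Covers-injective (inj₁ (_ , x , _ , _ , _ , ed-inj , _)) (tail j eq refl) (tail j′ eq′ refl) =
    cong (x ∘ inject₁) (ed-inj (trans eq (sym eq′)))
  Covers-injective (inj₁ (_ , x , _ , _ , _ , ed-inj , _)) (head j eq refl) (head j′ eq′ refl) =
    cong (x ∘ suc) (ed-inj (trans eq (sym eq′)))
  Covers-injective (inj₁ _) (end i refl _) (end .i refl _) = refl
  Covers-injective (inj₂ (_ , (y , _ , _ , _ , ed-inj , _) , _)) (tail j eq refl) (tail j′ eq′ refl) =
    cong y (ed-inj (trans eq (sym eq′)))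
  Covers-injective (inj₂ (_ , (y , _ , _ , _ , ed-inj , _) , _)) (head j eq refl) (head j′ eq′ refl) =
    cong (y ∘ suc) (Finₚ.inject₁-injective (ed-inj (trans eq (sym eq′))))

  Anchored : Fin n → Label → Set
  Anchored u (inj₁ (h , _)) = Incident G h u
  Anchored u (inj₂ (inj₁ (h , _))) = Incident G h u
  Anchored u (inj₂ (inj₂ i)) = Reach G F (rep i) u

  Covers-anchored : ∀ {r} (d : PecComp r) {u ℓ} → Covers d u ℓ → Anchored u ℓ
  Covers-anchored (inj₁ (_ , _ , _ , _ , _ , _ , ed-links , _)) (tail j refl refl) =
    Links⇒Incidentˡ (proj₂ (ed-links j))
  Covers-anchored (inj₁ (_ , _ , _ , _ , _ , _ , ed-links , _)) (head j refl refl) =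
    Links⇒Incidentʳ (proj₂ (ed-links j))
  Covers-anchored (inj₁ _) (end _ _ i↝u) = i↝u
  Covers-anchored (inj₂ (_ , (_ , _ , _ , _ , _ , _ , ed-links , ed-closes , _) , _)) (tail j refl refl) =
    cycle-edge-incident ed-links ed-closes j
  Covers-anchored (inj₂ (_ , (_ , _ , _ , _ , _ , _ , ed-links , _) , _)) (head j refl refl) =
    Links⇒Incidentʳ (ed-links j)

  Anchored-Reach : ∀ {u u′} ℓ → Anchored u ℓ → Anchored u′ ℓ → Reach G F u u′
  Anchored-Reach (inj₁ (_ , h∈H)) = Reach-incident (half⊆F h∈H)
  Anchored-Reach (inj₂ (inj₁ (_ , h∈H))) = Reach-incident (half⊆F h∈H)
  Anchored-Reach (inj₂ (inj₂ _)) i↝u i↝u′ = Reach-trans (Reach-sym i↝u) i↝u′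

  path-covering : ∀ {k} {x : Fin (suc k) → Fin n} {ed : Fin k → Fin m} →
    (∀ {h} → IndexParity ed true h → h ∈ H) →
    (∀ j → ed j ∈ F × Links G (ed j) (x (inject₁ j)) (x (suc j))) →
    (even k ≡ true → ∃[ i ] Reach G F (rep i) (x (fromℕ k))) →
    ∀ a → ∃[ ℓ ] PathCovers x ed (x a) ℓ
  path-covering {ed = ed} in-H _ end-rep a with even (toℕ a) in parity
  path-covering {k} {ed = ed} in-H _ end-rep a | true with view a
  ... | ‵inject₁ j = inj₁ (ed j , in-H (j , refl , trans (cong even (sym (toℕ-inject₁ j))) parity)) , tail j refl refl
  ... | ‵fromℕ = let (i , i↝end) = end-rep (trans (cong even (sym (toℕ-fromℕ k))) parity)
                 in inj₂ (inj₂ i) , end i refl i↝end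
  path-covering {ed = ed} in-H _ end-rep (suc j) | false =
    inj₂ (inj₁ (ed j , in-H (j , refl , not-injective parity))) , head j refl refl

  cycle-covering : ∀ {l} {y : Fin (suc l) → Fin n} {ed : Fin (suc l) → Fin m} →
    (∀ {h} → IndexParity ed true h → h ∈ H) → ∀ a → ∃[ ℓ ] CycleCovers y ed (y a) ℓ
  cycle-covering {ed = ed} in-H a with even (toℕ a) in parity
  cycle-covering {ed = ed} in-H a | true = inj₁ (ed a , in-H (a , refl , parity)) , tail a refl refl
  cycle-covering {ed = ed} in-H (suc j) | false =
    let even-j = trans (cong even (toℕ-inject₁ j)) (not-injective parity)
    in inj₂ (inj₁ (ed (inject₁ j) , in-H (inject₁ j , refl , even-j))) , head j refl refl

  covering : ∀ r {u} → Reach G F r u → ∃[ ℓ ] Covers (pec (root r)) u ℓ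
  covering r r↝u with pec (root r) | (λ {h} → Class⇒half r {h} true) | Reach-trans (Reach-sym (Reach-root r)) r↝u
  ... | inj₁ (k , p@(x , _ , x-spans , _ , _ , ed-links , _)) | in-H | root↝u with to (x-spans _) root↝u
  ...   | a , refl = path-covering in-H ed-links (end-rep ∘ even⇒2∣ k) a
    where
    end-rep : 2 ∣ k → ∃[ i ] Reach G F (rep i) (x (fromℕ k))
    end-rep 2∣k = let (i , i↝root) = rep-covers _ (k , p , 2∣k)
                  in i , Reach-trans i↝root (from (x-spans _) (fromℕ k , refl))
  covering r r↝u | inj₂ (_ , (y , _ , y-spans , _) , _) | in-H | root↝u with to (y-spans _) root↝u
  ... | a , refl = cycle-covering in-H a

  order≤twice-half+evenPaths : n ≤ ∣ H ∣ + (∣ H ∣ + e)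
  order≤twice-half+evenPaths =
    injective⇒≤ₛ ↔-refl (⊎-size (Elem-size H) (⊎-size (Elem-size H) ↔-refl))
                 (atRoot-injective id f f-injective same-component)
    where
    f : ∀ r u → Reach G F r u → Label
    f r u r↝u = proj₁ (covering r r↝u)
    f-injective : ∀ r {u u′} p p′ → f r u p ≡ f r u′ p′ → u ≡ u′
    f-injective r p p′ eq = Covers-injective (pec (root r)) (proj₂ (covering r p))
      (subst (Covers (pec (root r)) _) (sym eq) (proj₂ (covering r p′)))
    same-component : ∀ {u u′} → atRoot id f u ≡ atRoot id f u′ → Reach G F u u′
    same-component {u} {u′} eq = Anchored-Reach (atRoot id f u)
      (Covers-anchored _ (proj₂ (covering (root u) _)))
      (subst (Anchored u′) (sym eq) (Covers-anchored _ (proj₂ (covering (root u′) _))))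

module MatchingBound {n m : ℕ} (G : Graph n m) (F : Subset m) {H : Subset m}
                     (H-matching : IsMatching G H) (H⊆F : ∀ {f} → f ∈ H → f ∈ F) where
  open Graph G
  open GraphFacts G
  open Components G F

  Covered : Fin n → Set
  Covered u = ∃[ f ] f ∈ H × Incident G f u

  Covered? : ∀ u → Dec (Covered u)
  Covered? u = any? λ f → (f ∈? H) ×-dec Incident? f u

  even-path-uncovered : ∀ {v} → EvenPathComp G F v → ∃[ u ] Reach G F v u × ¬ Covered u
  even-path-uncovered {v} (k , (x , x-inj , x-spans , ed , ed-inj , ed-links , ed-covers) , divides q k≡q*2)
    with any? (λ a → ¬? (Covered? (x a)))
  ... | yes (a , ¬covered) = x a , from (x-spans _) (a , refl) , ¬covered
  ... | no none = ⊥-elim (ℕ.<-irrefl (trans j≡q*2 (sym k≡q*2)) (Finₚ.toℕ<n j))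
    where
    covered : ∀ a → Covered (x a)
    covered a = Dec.decidable-stable (Covered? (x a)) (λ ¬covered → none (a , ¬covered))

    -- By induction on t: the H-edge at x (2t) is the path edge leaving it, for otherwise
    -- it would share x (2t - 1) with the H-edge leaving x (2t - 2).
    leaving-in-H : ∀ t (a : Fin (suc k)) → toℕ a ≡ t * 2 → ∃[ j ] toℕ j ≡ t * 2 × ed j ∈ H
    leaving-in-H t a a≡2t with covered a
    ... | f , f∈H , f∋xa with ed-covers f (H⊆F f∈H) (x a , from (x-spans _) (a , refl) , f∋xa)
    ...   | j , refl with path-edge-ends x-inj (proj₂ ∘ ed-links) j a f∋xa | t
    ...     | inj₁ a≡j | _ = j , trans (sym a≡j) a≡2t , f∈H
    ...     | inj₂ a≡1+j | zero with () ← trans (sym a≡1+j) a≡2t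
    ...     | inj₂ a≡1+j | suc t′ = ⊥-elim (H-matching (ed j) (ed j′) f∈H j′∈H ed-j≢ed-j′ _
                                      (Links⇒Incidentˡ (proj₂ (ed-links j))) j′∋xj)
      where
      2t′<1+k : t′ * 2 < suc k
      2t′<1+k = ℕ.<-trans (ℕ.n<1+n _) (ℕ.<-trans (ℕ.n<1+n _) (subst (_< suc k) a≡2t (Finₚ.toℕ<n a)))
      previous = leaving-in-H t′ (Fin.fromℕ< 2t′<1+k) (Finₚ.toℕ-fromℕ< 2t′<1+k)
      j′ = proj₁ previous
      j′≡2t′ = proj₁ (proj₂ previous)
      j′∈H = proj₂ (proj₂ previous)
      j≡1+2t′ : toℕ j ≡ suc (t′ * 2)
      j≡1+2t′ = ℕ.suc-injective (trans (sym a≡1+j) a≡2t)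
      ed-j≢ed-j′ : ed j ≢ ed j′
      ed-j≢ed-j′ eq = ℕ.1+n≢n (trans (sym j≡1+2t′) (trans (cong toℕ (ed-inj eq)) j′≡2t′))
      j′∋xj : Incident G (ed j′) (x (inject₁ j))
      j′∋xj = subst (λ i → Incident G (ed j′) (x i))
                (Finₚ.toℕ-injective (trans (cong suc j′≡2t′) (sym (trans (toℕ-inject₁ j) j≡1+2t′))))
                (Links⇒Incidentʳ (proj₂ (ed-links j′)))

    j = proj₁ (leaving-in-H q (fromℕ k) (trans (toℕ-fromℕ k) k≡q*2))
    j≡q*2 = proj₁ (proj₂ (leaving-in-H q (fromℕ k) (trans (toℕ-fromℕ k) k≡q*2)))

  2∣H∣+evenPaths≤order : ∀ {e} → ECount G F e → ∣ H ∣ + (∣ H ∣ + e) ≤ n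
  2∣H∣+evenPaths≤order {e} (rep , rep-distinct , rep-even , _) =
    injective⇒≤ₛ (⊎-size (Elem-size H) (⊎-size (Elem-size H) ↔-refl)) ↔-refl {f = vertex} vertex-injective
    where
    uncovered : Fin e → Fin n
    uncovered i = proj₁ (even-path-uncovered (rep-even i))
    rep↝uncovered : ∀ i → Reach G F (rep i) (uncovered i)
    rep↝uncovered i = proj₁ (proj₂ (even-path-uncovered (rep-even i)))
    uncovered-¬Covered : ∀ i → ¬ Covered (uncovered i)
    uncovered-¬Covered i = proj₂ (proj₂ (even-path-uncovered (rep-even i)))

    vertex : Elem H ⊎ (Elem H ⊎ Fin e) → Fin n
    vertex (inj₁ (f , _)) = src f
    vertex (inj₂ (inj₁ (f , _))) = tgt f
    vertex (inj₂ (inj₂ i)) = uncovered i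

    vertex-covered : ∀ {f} → f ∈ H → ∀ i → uncovered i ≢ src f × uncovered i ≢ tgt f
    vertex-covered f∈H i = (λ eq → uncovered-¬Covered i (_ , f∈H , inj₁ (sym eq)))
                         , (λ eq → uncovered-¬Covered i (_ , f∈H , inj₂ (sym eq)))

    vertex-injective : Injective _≡_ _≡_ vertex
    vertex-injective {inj₁ (f , f∈H)} {inj₁ (f′ , f′∈H)} eq =
      cong inj₁ (Elem-≡ (matching-unique H-matching f∈H f′∈H (inj₁ refl) (inj₁ (sym eq))))
    vertex-injective {inj₁ (f , f∈H)} {inj₂ (inj₁ (f′ , f′∈H))} eq
      with refl ← matching-unique H-matching f∈H f′∈H (inj₁ refl) (inj₂ (sym eq)) = ⊥-elim (loopless f eq)
    vertex-injective {inj₁ (_ , f∈H)} {inj₂ (inj₂ i)} eq = ⊥-elim (proj₁ (vertex-covered f∈H i) (sym eq))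
    vertex-injective {inj₂ (inj₁ (f , f∈H))} {inj₁ (f′ , f′∈H)} eq
      with refl ← matching-unique H-matching f∈H f′∈H (inj₂ refl) (inj₁ (sym eq)) = ⊥-elim (loopless f (sym eq))
    vertex-injective {inj₂ (inj₁ (f , f∈H))} {inj₂ (inj₁ (f′ , f′∈H))} eq =
      cong (inj₂ ∘ inj₁) (Elem-≡ (matching-unique H-matching f∈H f′∈H (inj₂ refl) (inj₂ (sym eq))))
    vertex-injective {inj₂ (inj₁ (_ , f∈H))} {inj₂ (inj₂ i)} eq = ⊥-elim (proj₂ (vertex-covered f∈H i) (sym eq))
    vertex-injective {inj₂ (inj₂ i)} {inj₁ (_ , f∈H)} eq = ⊥-elim (proj₁ (vertex-covered f∈H i) eq)
    vertex-injective {inj₂ (inj₂ i)} {inj₂ (inj₁ (_ , f∈H))} eq = ⊥-elim (proj₂ (vertex-covered f∈H i) eq)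
    vertex-injective {inj₂ (inj₂ i)} {inj₂ (inj₂ i′)} eq = cong (inj₂ ∘ inj₂)
      (rep-distinct i i′ (Reach-trans (rep↝uncovered i)
                                      (subst (λ u → Reach G F u _) (sym eq) (Reach-sym (rep↝uncovered i′)))))

module MatchingUnion {n m : ℕ} (G : Graph n m) (K K′ : Subset m)
                     (K-matching : IsMatching G K) (K′-matching : IsMatching G K′)
                     (disjoint : EdgeDisjoint G K K′) where
  open Graph G
  open GraphFacts G
  open Components G (K ∪ K′)

  F : Subset m
  F = K ∪ K′

  Mat : Bool → Subset m
  Mat true = K
  Mat false = K′

  Mat⊆F : ∀ {b f} → f ∈ Mat b → f ∈ F
  Mat⊆F {true} f∈K = x∈p∪q⁺ (inj₁ f∈K)
  Mat⊆F {false} f∈K′ = x∈p∪q⁺ (inj₂ f∈K′)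

  F⊆Mat : ∀ {f} → f ∈ F → ∃[ b ] f ∈ Mat b
  F⊆Mat f∈F = Sum.[ (true ,_) , (false ,_) ] (x∈p∪q⁻ K K′ f∈F)

  Mat-matching : ∀ b → IsMatching G (Mat b)
  Mat-matching true = K-matching
  Mat-matching false = K′-matching

  Mat-colour-unique : ∀ {b b′ f} → f ∈ Mat b → f ∈ Mat b′ → b ≡ b′
  Mat-colour-unique {true} {true} _ _ = refl
  Mat-colour-unique {true} {false} f∈K f∈K′ = ⊥-elim (disjoint _ f∈K f∈K′)
  Mat-colour-unique {false} {true} f∈K′ f∈K = ⊥-elim (disjoint _ f∈K f∈K′)
  Mat-colour-unique {false} {false} _ _ = refl

  recolour : ∀ {b b′ f} → b ≡ b′ → f ∈ Mat b → f ∈ Mat b′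
  recolour = subst (λ b → _ ∈ Mat b)

  Mat-unique : ∀ {b f g u} → f ∈ Mat b → g ∈ Mat b → Incident G f u → Incident G g u → f ≡ g
  Mat-unique {b} = matching-unique (Mat-matching b)

  EdgeAt : Bool → Fin n → Set
  EdgeAt b u = ∃[ f ] f ∈ Mat b × Incident G f u

  EdgeAt? : ∀ b u → Dec (EdgeAt b u)
  EdgeAt? b u = any? λ f → (f ∈? Mat b) ×-dec Incident? f u

  module Walk (s : Fin n) (c : Bool) where

    colour : ℕ → Bool
    colour zero = c
    colour (suc t) = not (colour t)

    colour-parity : ∀ t → colour t ≡ (if even t then c else not c)
    colour-parity zero = refl
    colour-parity (suc t) with even t | colour-parity t
    ... | true | colour-t = cong not colour-t
    ... | false | colour-t = trans (cong not colour-t) (not-involutive c)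

    colour≡start⇒even : ∀ t → colour t ≡ c → even t ≡ true
    colour≡start⇒even t colour≡c with even t | colour-parity t
    ... | true | _ = refl
    ... | false | colour-t = ⊥-elim (not-¬ refl (trans (sym colour≡c) colour-t))

    data At : ℕ → Fin n → Set where
      start : At 0 s
      step  : ∀ {t u w f} → At t u → f ∈ Mat (colour t) → Links G f u w → At (suc t) w

    At-zero : ∀ {u} → At 0 u → u ≡ s
    At-zero start = refl

    At-deterministic : ∀ {t u u′} → At t u → At t u′ → u ≡ u′
    At-deterministic start start = refl
    At-deterministic (step at f∈ l) (step at′ f′∈ l′) with refl ← At-deterministic at at′
      with refl ← Mat-unique f∈ f′∈ (Links⇒Incidentˡ l) (Links⇒Incidentˡ l′) = Links-functional l l′

    At-Reach : ∀ {t u} → At t u → Reach G F s u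
    At-Reach start = here
    At-Reach (step at f∈ l) = step _ (Mat⊆F f∈) l (At-Reach at)

    Alive : ℕ → Set
    Alive t = ∃[ u ] At t u

    Alive? : ∀ t → Dec (Alive t)
    Alive? zero = yes (s , start)
    Alive? (suc t) with Alive? t
    ... | no dead = no λ { (_ , step at _ _) → dead (_ , at) }
    ... | yes (u , at) with EdgeAt? (colour t) u
    ...   | yes (f , f∈ , f∋u) = yes (_ , step at f∈ (proj₂ (Incident⇒Links f∋u)))
    ...   | no none = no λ { (_ , step at′ f∈ l) →
                             none (_ , f∈ , subst (Incident G _) (At-deterministic at′ at) (Links⇒Incidentˡ l)) }

    At? : ∀ t u → Dec (At t u)
    At? t u with Alive? t
    ... | no dead = no λ at → dead (u , at)
    ... | yes (u′ , at) with u′ Fin.≟ u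
    ...   | yes refl = yes at
    ...   | no u′≢u = no (u′≢u ∘ At-deterministic at)

    Alive-prefix : ∀ {t t′ u} → At t u → t′ ≤ t → Alive t′
    Alive-prefix at t′≤t with ℕ.m≤n⇒m<n∨m≡n t′≤t
    ... | inj₂ refl = _ , at
    Alive-prefix (step at _ _) _ | inj₁ (s≤s t′≤t) = Alive-prefix at t′≤t

    leaving-edge : ∀ {t u w} → At t u → At (suc t) w → ∃[ f ] f ∈ Mat (colour t) × Links G f u w
    leaving-edge at (step at′ f∈ l) = _ , f∈ , subst (λ u → Links G _ u _) (At-deterministic at′ at) l

    -- A vertex has at most one edge of each colour, so a revisit can be retraced backwards.
    revisit-same-phase : ∀ i j {u} → i ≤ j → colour i ≡ colour j → At i u → At j u →
                         At (j ∸ i) s × colour (j ∸ i) ≡ c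
    revisit-same-phase zero j _ same at₀ atⱼ with refl ← At-zero at₀ = atⱼ , sym same
    revisit-same-phase (suc i) (suc j) (s≤s i≤j) same (step atᵢ f∈ l) (step atⱼ f′∈ l′)
      with refl ← Mat-unique f∈ (recolour (sym (not-injective same)) f′∈) (Links⇒Incidentʳ l) (Links⇒Incidentʳ l′)
      with refl ← Links-functional (Links-sym l) (Links-sym l′) =
      revisit-same-phase i j i≤j (not-injective same) atᵢ atⱼ

    revisit-opposite-phase : ∀ i j {u} → i < j → colour i ≢ colour j → At i u → At j u → ⊥
    revisit-opposite-phase i (suc j) (s≤s i≤j) differ atᵢ (step atⱼ f∈ l)
      with Alive-prefix (step atⱼ f∈ l) (s≤s i≤j)
    ... | w , atᵢ₊₁ with leaving-edge atᵢ atᵢ₊₁ | trans (¬-not differ) (not-involutive (colour j))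
    ...   | g , g∈ , g-links | colour-i≡colour-j
      with refl ← Mat-unique g∈ (recolour (sym colour-i≡colour-j) f∈) (Links⇒Incidentˡ g-links) (Links⇒Incidentʳ l)
      with refl ← Links-functional (Links-sym l) g-links with ℕ.m≤n⇒m<n∨m≡n i≤j
    ...     | inj₂ refl = Links-irreflexive (subst (λ v → Links G _ v _) (At-deterministic atⱼ atᵢ) l)
    ...     | inj₁ i<j with ℕ.m≤n⇒m<n∨m≡n i<j
    ...       | inj₂ refl = not-¬ refl colour-i≡colour-j
    ...       | inj₁ i+1<j = revisit-opposite-phase (suc i) j i+1<j
                                 (λ eq → not-¬ refl (trans colour-i≡colour-j (sym eq))) atᵢ₊₁ atⱼ

    revisit⇒return : ∀ i j {u} → i < j → At i u → At j u →
                     ∃[ d ] At (suc d) s × colour (suc d) ≡ c × suc d ≤ j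
    revisit⇒return i j i<j atᵢ atⱼ with colour i Bool.≟ colour j
    ... | no differ = ⊥-elim (revisit-opposite-phase i j i<j differ atᵢ atⱼ)
    ... | yes same with j ∸ i in j∸i≡ | revisit-same-phase i j (ℕ.<⇒≤ i<j) same atᵢ atⱼ
    ...   | zero | _ = ⊥-elim (ℕ.m>n⇒m∸n≢0 i<j j∸i≡)
    ...   | suc d | at , colour≡c = d , at , colour≡c , subst (_≤ j) j∸i≡ (ℕ.m∸n≤m j i)

    return⇒back-edge : ∀ {d} → At (suc d) s → colour (suc d) ≡ c → EdgeAt (not c) s
    return⇒back-edge {d} (step _ f∈ l) colour≡c =
      _ , recolour (trans (sym (not-involutive (colour d))) (cong not colour≡c)) f∈ , Links⇒Incidentʳ l

    module Segment {k e} (atₖ : At k e) where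

      visit : (i : Fin (suc k)) → Alive (toℕ i)
      visit i = Alive-prefix atₖ (ℕ.≤-pred (Finₚ.toℕ<n i))

      x : Fin (suc k) → Fin n
      x = proj₁ ∘ visit

      x-At : ∀ {t} i → toℕ i ≡ t → At t (x i)
      x-At i refl = proj₂ (visit i)

      x-zero : x zero ≡ s
      x-zero = At-zero (x-At zero refl)

      x-last : x (fromℕ k) ≡ e
      x-last = At-deterministic (x-At (fromℕ k) (toℕ-fromℕ k)) atₖ

      leaving : (i : Fin k) → ∃[ f ] f ∈ Mat (colour (toℕ i)) × Links G f (x (inject₁ i)) (x (suc i))
      leaving i = leaving-edge (x-At (inject₁ i) (toℕ-inject₁ i)) (x-At (suc i) refl)

      ed : Fin k → Fin m
      ed = proj₁ ∘ leaving

      ed-Mat : ∀ i → ed i ∈ Mat (colour (toℕ i))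
      ed-Mat = proj₁ ∘ proj₂ ∘ leaving

      ed-links : ∀ i → Links G (ed i) (x (inject₁ i)) (x (suc i))
      ed-links = proj₂ ∘ proj₂ ∘ leaving

      revisit⇒return-by : ∀ {i j} → i Fin.< j → x i ≡ x j →
                          ∃[ d ] At (suc d) s × colour (suc d) ≡ c × suc d ≤ toℕ j
      revisit⇒return-by {i} {j} i<j eq = revisit⇒return _ _ i<j (x-At i refl) (subst (At _) (sym eq) (x-At j refl))

    module PathFrom (no-back : ¬ EdgeAt (not c) s) {k e} (atₖ : At k e) (stuck : ¬ Alive (suc k)) where
      open Segment atₖ

      x-inj : Injective _≡_ _≡_ x
      x-inj = <-distinct⇒injective x λ i<j eq →
        let (_ , at , colour≡c , _) = revisit⇒return-by i<j eq in no-back (return⇒back-edge at colour≡c)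

      edges-at : ∀ i {f} → f ∈ F → Incident G f (x i) → ∃[ j ] ed j ≡ f
      edges-at i f∈F f∋x with F⊆Mat f∈F
      ... | b , f∈ with b Bool.≟ colour (toℕ i) | view i
      ...   | yes refl | ‵inject₁ j =
        j , Mat-unique (ed-Mat j) (recolour (cong colour (toℕ-inject₁ j)) f∈) (Links⇒Incidentˡ (ed-links j)) f∋x
      ...   | yes refl | ‵fromℕ =
        ⊥-elim (stuck (_ , step (x-At (fromℕ k) (toℕ-fromℕ k)) (recolour (cong colour (toℕ-fromℕ k)) f∈)
                                (proj₂ (Incident⇒Links f∋x))))
      edges-at zero {f} f∈F f∋x | b , f∈ | no b≢c | _ =
        ⊥-elim (no-back (f , recolour (¬-not b≢c) f∈ , subst (Incident G f) x-zero f∋x))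
      edges-at (suc j) f∈F f∋x | b , f∈ | no b≢ | _ =
        j , Mat-unique (ed-Mat j) (recolour (trans (¬-not b≢) (not-involutive _)) f∈)
                       (Links⇒Incidentʳ (ed-links j)) f∋x

      x-spans : Spans s x
      x-spans u = mk⇔ reached (λ { (i , refl) → At-Reach (x-At i refl) })
        where
        reached : ∀ {u} → Reach G F s u → ∃[ i ] x i ≡ u
        reached here = zero , x-zero
        reached (step f f∈F l s↝u) with reached s↝u
        ... | i , refl with edges-at i f∈F (Links⇒Incidentˡ l)
        ...   | j , refl with Links-ends (ed-links j) (Links⇒Incidentʳ l)
        ...     | inj₁ eq = inject₁ j , sym eq
        ...     | inj₂ eq = suc j , sym eq

      ed-inj : Injective _≡_ _≡_ ed
      ed-inj {i} {j} eq with Links-unique (ed-links i) (subst (λ f → Links G f _ _) (sym eq) (ed-links j))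
      ... | inj₁ (xi≡xj , _) = Finₚ.inject₁-injective (x-inj xi≡xj)
      ... | inj₂ (xi≡xj+1 , xi+1≡xj) = ⊥-elim (ℕ.m≢1+n+m (toℕ j) {1} (sym (trans (cong suc (sym i≡1+j)) 1+i≡j)))
        where
        i≡1+j : toℕ i ≡ suc (toℕ j)
        i≡1+j = trans (sym (toℕ-inject₁ i)) (cong toℕ (x-inj xi≡xj+1))
        1+i≡j : suc (toℕ i) ≡ toℕ j
        1+i≡j = trans (cong toℕ (x-inj xi+1≡xj)) (toℕ-inject₁ j)

      path : IsPathComp G F s k
      path = x , x-inj , x-spans , ed , ed-inj , (λ i → Mat⊆F (ed-Mat i) , ed-links i) ,
             λ f f∈F (u , s↝u , f∋u) → let (i , xi≡u) = to (x-spans u) s↝u in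
                                      edges-at i f∈F (subst (Incident G f) (sym xi≡u) f∋u)

    module CycleFrom {l} (return : At (suc l) s) (minimal : ∀ d → At (suc d) s → d < l → ⊥) where
      open Segment return

      y : Fin (suc l) → Fin n
      y = x ∘ inject₁

      colour-return : colour (suc l) ≡ c
      colour-return with colour (suc l) Bool.≟ c
      ... | yes same = same
      ... | no differ = ⊥-elim (revisit-opposite-phase 0 (suc l) (s≤s z≤n) (differ ∘ sym) start return)

      colour-last : colour l ≡ not c
      colour-last = trans (sym (not-involutive (colour l))) (cong not colour-return)

      y-inj : Injective _≡_ _≡_ y
      y-inj = <-distinct⇒injective y λ {i} {j} i<j eq →
        let (d , at , _ , d<j) = revisit⇒return-by {inject₁ i} {inject₁ j}
                                   (subst₂ _<_ (sym (toℕ-inject₁ i)) (sym (toℕ-inject₁ j)) i<j) eq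
        in minimal d at (ℕ.≤-trans d<j (ℕ.≤-trans (ℕ.≤-reflexive (toℕ-inject₁ j)) (ℕ.≤-pred (Finₚ.toℕ<n j))))

      y-closes : x (suc (fromℕ l)) ≡ y zero
      y-closes = trans x-last (sym x-zero)

      edges-at : ∀ i {f} → f ∈ F → Incident G f (y i) → ∃[ j ] ed j ≡ f
      edges-at i f∈F f∋y with F⊆Mat f∈F
      ... | b , f∈ with b Bool.≟ colour (toℕ i)
      ...   | yes refl = i , Mat-unique (ed-Mat i) f∈ (Links⇒Incidentˡ (ed-links i)) f∋y
      edges-at zero f∈F f∋y | b , f∈ | no b≢c = fromℕ l ,
        Mat-unique (ed-Mat (fromℕ l)) (recolour (trans (¬-not b≢c) (sym (trans (cong colour (toℕ-fromℕ l)) colour-last))) f∈)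
                   (subst (Incident G _) y-closes (Links⇒Incidentʳ (ed-links (fromℕ l)))) f∋y
      edges-at (suc j) f∈F f∋y | b , f∈ | no b≢ = inject₁ j ,
        Mat-unique (ed-Mat (inject₁ j))
                   (recolour (trans (trans (¬-not b≢) (not-involutive _)) (cong colour (sym (toℕ-inject₁ j)))) f∈)
                   (Links⇒Incidentʳ (ed-links (inject₁ j))) f∋y

      y-spans : Spans s y
      y-spans u = mk⇔ reached (λ { (i , refl) → At-Reach (x-At (inject₁ i) refl) })
        where
        next : ∀ j → ∃[ i ] x (suc j) ≡ y i
        next j with view j
        ... | ‵inject₁ i = suc i , refl
        ... | ‵fromℕ = zero , y-closes
        reached : ∀ {u} → Reach G F s u → ∃[ i ] y i ≡ u
        reached here = zero , x-zero
        reached (step f f∈F l s↝u) with reached s↝u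
        ... | i , refl with edges-at i f∈F (Links⇒Incidentˡ l)
        ...   | j , refl with Links-ends (ed-links j) (Links⇒Incidentʳ l)
        ...     | inj₁ eq = j , sym eq
        ...     | inj₂ eq = proj₁ (next j) , sym (trans eq (proj₂ (next j)))

      ed-inj : Injective _≡_ _≡_ ed
      ed-inj {i} {j} eq with Links-unique (ed-links i) (subst (λ f → Links G f _ _) (sym eq) (ed-links j))
                           | Mat-colour-unique (ed-Mat i) (subst (λ f → f ∈ Mat _) (sym eq) (ed-Mat j))
      ... | inj₁ (yi≡yj , _) | _ = y-inj yi≡yj
      ... | inj₂ (yi≡next , _) | same-colour with view j
      ...   | ‵inject₁ t with refl ← y-inj {i} {suc t} yi≡next =
        ⊥-elim (not-¬ refl (trans (cong colour (sym (toℕ-inject₁ t))) (sym same-colour)))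
      ...   | ‵fromℕ with refl ← y-inj {i} {zero} (trans yi≡next y-closes) =
        ⊥-elim (not-¬ refl (trans same-colour (trans (cong colour (toℕ-fromℕ l)) colour-last)))

      cycle : IsCycleComp G F s l
      cycle = y , y-inj , y-spans , ed , ed-inj , Mat⊆F ∘ ed-Mat , ed-links ∘ inject₁ ,
              subst (Links G (ed (fromℕ l)) (y (fromℕ l))) y-closes (ed-links (fromℕ l)) ,
              λ f f∈F (u , s↝u , f∋u) → let (i , yi≡u) = to (y-spans u) s↝u in
                                       edges-at i f∈F (subst (Incident G f) (sym yi≡u) f∋u)

      even-length : 2 ∣ suc l
      even-length = even⇒2∣ (suc l) (colour≡start⇒even (suc l) colour-return)

    Stuck : ℕ → Set
    Stuck t = Alive t × ¬ Alive (suc t)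

    Stuck? : ∀ t → Dec (Stuck t)
    Stuck? t = Alive? t ×-dec ¬? (Alive? (suc t))

    alive-unless-stuck : ¬ (∃ λ (t : Fin n) → Stuck (toℕ t)) → ∀ t → t ≤ n → Alive t
    alive-unless-stuck never-stuck zero _ = s , start
    alive-unless-stuck never-stuck (suc t) t<n with Alive? (suc t)
    ... | yes alive = alive
    ... | no dead = ⊥-elim (never-stuck (Fin.fromℕ< t<n ,
        subst Stuck (sym (Finₚ.toℕ-fromℕ< t<n)) (alive-unless-stuck never-stuck t (ℕ.<⇒≤ t<n) , dead)))

    alive-within : ¬ (∃ λ (t : Fin n) → Stuck (toℕ t)) → (t : Fin (suc n)) → Alive (toℕ t)
    alive-within never-stuck t = alive-unless-stuck never-stuck (toℕ t) (ℕ.≤-pred (Finₚ.toℕ<n t))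

    -- If the walk survives n steps, two of its first n + 1 positions coincide.
    stuck-or-returns : (∃[ t ] Stuck t) ⊎ (∃[ d ] At (suc d) s × colour (suc d) ≡ c × d < n)
    stuck-or-returns with any? (Stuck? ∘ toℕ {n})
    ... | yes (t , stuck) = inj₁ (toℕ t , stuck)
    ... | no never-stuck with Finₚ.pigeonhole (ℕ.n<1+n n) (proj₁ ∘ alive-within never-stuck)
    ...   | i , j , i<j , same-vertex =
      let (d , at , colour≡c , d<j) = revisit⇒return _ _ i<j (proj₂ (alive-within never-stuck i))
                                        (subst (At _) (sym same-vertex) (proj₂ (alive-within never-stuck j)))
      in inj₂ (d , at , colour≡c , ℕ.≤-trans d<j (ℕ.≤-pred (Finₚ.toℕ<n j)))

  path-from : ∀ a b → ¬ EdgeAt (not b) a → PathComp G F a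
  path-from a b no-back with Walk.stuck-or-returns a b
  ... | inj₁ (k , (_ , atₖ) , dead) = k , Walk.PathFrom.path a b no-back atₖ dead
  ... | inj₂ (_ , at , colour≡c , _) = ⊥-elim (no-back (Walk.return⇒back-edge a b at colour≡c))

  union-pec : IsPec G F
  union-pec v with Walk.stuck-or-returns v true
  ... | inj₁ (t , (a , atₜ) , dead) =
    inj₁ (PathComp-move (path-from a (not colour-t) no-back) (Reach-sym (Walk.At-Reach v true atₜ)))
    where
    colour-t = Walk.colour v true t
    -- an edge of colour colour-t at a would prolong the walk
    no-back : ¬ EdgeAt (not (not colour-t)) a
    no-back (f , f∈ , f∋a) =
      dead (_ , Walk.step atₜ (recolour (not-involutive colour-t) f∈) (proj₂ (Incident⇒Links f∋a)))
  ... | inj₂ (d , return , _ , d<n) =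
    inj₂ (l , Walk.CycleFrom.cycle v true first-return minimal , Walk.CycleFrom.even-length v true first-return minimal)
    where
    open Walk v true using (At; At?)
    Returns : Fin n → Set
    Returns d = At (suc (toℕ d)) v
    returns : ∀ {d} (d<n : d < n) → At (suc d) v → Returns (Fin.fromℕ< d<n)
    returns d<n = subst (λ d → At (suc d) v) (sym (Finₚ.toℕ-fromℕ< d<n))
    first : Σ (Fin n) λ d → Returns d × (∀ d′ → Returns d′ → d Fin.≤ d′)
    first = least (λ d → At? (suc (toℕ d)) v) (_ , returns d<n return)
    l : ℕ
    l = toℕ (proj₁ first)
    first-return : At (suc l) v
    first-return = proj₁ (proj₂ first)
    minimal : ∀ d → At (suc d) v → d < l → ⊥
    minimal d return′ d<l = ℕ.<⇒≱ d<l
      (subst (l ≤_) (Finₚ.toℕ-fromℕ< d<n′) (proj₂ (proj₂ first) _ (returns d<n′ return′)))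
      where
      d<n′ : d < n
      d<n′ = ℕ.<-trans d<l (Finₚ.toℕ<n (proj₁ first))

a+a+x≤b+b+x⇒a≤b : ∀ a b x → a + (a + x) ≤ b + (b + x) → a ≤ b
a+a+x≤b+b+x⇒a≤b a b x le with a ℕ.≤? b
... | yes a≤b = a≤b
... | no a≰b = let b<a = ℕ.≰⇒> a≰b in ⊥-elim (ℕ.<⇒≱ (ℕ.+-mono-< b<a (ℕ.+-monoˡ-< x b<a)) le)

a+a+x≤a+a+y⇒x≤y : ∀ a x y → a + (a + x) ≤ a + (a + y) → x ≤ y
a+a+x≤a+a+y⇒x≤y a x y = ℕ.+-cancelˡ-≤ a x y ∘ ℕ.+-cancelˡ-≤ a (a + x) (a + y)

module _ {n m : ℕ} (G : Graph n m) where

  DisjPair-pec : ∀ {K K′} → DisjPair G K K′ → IsPec G (K ∪ K′)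
  DisjPair-pec (K-matching , K′-matching , disjoint) = MatchingUnion.union-pec G _ _ K-matching K′-matching disjoint

  halves-DisjPair : ∀ {F} (pec : IsPec G F) → DisjPair G (ParitySplit.half G F pec true) (ParitySplit.half G F pec false)
  halves-DisjPair pec = half-matching true , half-matching false , halves-disjoint
    where open ParitySplit G _ pec

  order≡halves+paths : ∀ {F c} (pec : IsPec G F) → PCount G F c →
                       n ≡ ∣ ParitySplit.half G F pec true ∣ + ∣ ParitySplit.half G F pec false ∣ + c
  order≡halves+paths pec paths =
    trans (VertexCount.order≡size+paths G _ pec paths) (cong (_+ _) (ParitySplit.∣F∣≡∣halves∣ G _ pec))

  DisjPair+p≤order : ∀ {p K K′} → IsP G p → DisjPair G K K′ → ∣ K ∣ + ∣ K′ ∣ + p ≤ n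
  DisjPair+p≤order {K = K} {K′} (_ , p-min) pair@(_ , _ , disjoint) = begin
    ∣ K ∣ + ∣ K′ ∣ + _ ≤⟨ ℕ.+-monoʳ-≤ (∣ K ∣ + ∣ K′ ∣) (p-min _ c pec paths) ⟩
    ∣ K ∣ + ∣ K′ ∣ + c ≡⟨ cong (_+ c) (∣p∪q∣≡∣p∣+∣q∣ K K′ disjoint) ⟨
    ∣ K ∪ K′ ∣ + c     ≡⟨ VertexCount.order≡size+paths G _ pec paths ⟨
    n                  ∎
    where
    open ℕ.≤-Reasoning
    pec = DisjPair-pec pair
    c = proj₁ (Pec.pathCount G _ pec)
    paths = proj₂ (Pec.pathCount G _ pec)

  order≡2ν+e : ∀ {ν e} → IsNu G ν → IsE G e → n ≡ ν + (ν + e)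
  order≡2ν+e {ν} {e} ((M , M-matching , ∣M∣≡ν) , ν-max) ((_ , Fₑ-pec , Fₑ-evenPaths) , e-min) =
    ℕ.≤-antisym order≤ ≤order
    where
    order≤ : n ≤ ν + (ν + e)
    order≤ = ℕ.≤-trans (EvenHalfCover.order≤twice-half+evenPaths G _ Fₑ-pec Fₑ-evenPaths)
                       (ℕ.+-mono-≤ half≤ν (ℕ.+-monoˡ-≤ e half≤ν))
      where half≤ν = ν-max _ (ParitySplit.half-matching G _ Fₑ-pec true)
    M-pair : DisjPair G M ∅
    M-pair = M-matching , (λ _ _ e∈⊥ → ⊥-elim (Subₚ.∉⊥ e∈⊥)) , λ _ _ → Subₚ.∉⊥
    c = proj₁ (Pec.evenPathCount G _ (DisjPair-pec M-pair))
    evenPaths = proj₂ (Pec.evenPathCount G _ (DisjPair-pec M-pair))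
    ≤order : ν + (ν + e) ≤ n
    ≤order = subst (λ k → k + (k + e) ≤ n) ∣M∣≡ν
      (ℕ.≤-trans (ℕ.+-monoʳ-≤ ∣ M ∣ (ℕ.+-monoʳ-≤ ∣ M ∣ (e-min _ c (DisjPair-pec M-pair) evenPaths)))
                 (MatchingBound.2∣H∣+evenPaths≤order G _ M-matching (x∈p∪q⁺ ∘ inj₁) evenPaths))

  halves-InΛ : ∀ {F p} → IsP G p → (pec : IsPec G F) → PCount G F p →
               InΛ G (ParitySplit.half G F pec true) (ParitySplit.half G F pec false)
  halves-InΛ {p = p} p-isP pec paths = halves-DisjPair pec , λ K K′ pair → ℕ.+-cancelʳ-≤ p _ _
    (ℕ.≤-trans (DisjPair+p≤order p-isP pair) (ℕ.≤-reflexive (order≡halves+paths pec paths)))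

  InΛ-pathCount : ∀ {H H′ p} → IsP G p → InΛ G H H′ → PCount G (H ∪ H′) p
  InΛ-pathCount {H} {H′} {p} ((Fₚ , Fₚ-pec , Fₚ-paths) , p-min) (pair@(_ , _ , disjoint) , λ-max) =
    subst (PCount G (H ∪ H′)) (ℕ.≤-antisym c≤p (p-min _ c pec paths)) paths
    where
    open ℕ.≤-Reasoning
    pec = DisjPair-pec pair
    c = proj₁ (Pec.pathCount G _ pec)
    paths = proj₂ (Pec.pathCount G _ pec)
    open ParitySplit G Fₚ Fₚ-pec using (half)
    c≤p : c ≤ p
    c≤p = ℕ.+-cancelˡ-≤ ∣ H ∪ H′ ∣ c p (begin
      ∣ H ∪ H′ ∣ + c                    ≡⟨ VertexCount.order≡size+paths G _ pec paths ⟨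
      n                                 ≡⟨ order≡halves+paths Fₚ-pec Fₚ-paths ⟩
      ∣ half true ∣ + ∣ half false ∣ + p ≤⟨ ℕ.+-monoˡ-≤ p (λ-max _ _ (halves-DisjPair Fₚ-pec)) ⟩
      ∣ H ∣ + ∣ H′ ∣ + p                 ≡⟨ cong (_+ p) (∣p∪q∣≡∣p∣+∣q∣ H H′ disjoint) ⟨
      ∣ H ∪ H′ ∣ + p                    ∎)

  e≤eₚ : ∀ {e eₚ} → IsE G e → IsEp G eₚ → e ≤ eₚ
  e≤eₚ (_ , e-min) (_ , _ , (_ , pec , _ , evenPaths) , _) = e-min _ _ pec evenPaths

  μ≤ν : ∀ {ν μ} → IsNu G ν → IsMu G μ → μ ≤ ν
  μ≤ν (_ , ν-max) ((H , _ , ((H-matching , _) , _) , ∣H∣≡μ) , _) = subst (_≤ _) ∣H∣≡μ (ν-max H H-matching)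

  InΛ⇒2∣H∣+eₚ≤order : ∀ {eₚ H H′} → IsEp G eₚ → InΛ G H H′ → ∣ H ∣ + (∣ H ∣ + eₚ) ≤ n
  InΛ⇒2∣H∣+eₚ≤order {H = H} (_ , p-isP , _ , eₚ-min) HH′∈Λ@((H-matching , _) , _) =
    ℕ.≤-trans (ℕ.+-monoʳ-≤ ∣ H ∣ (ℕ.+-monoʳ-≤ ∣ H ∣ (eₚ-min _ c pec (InΛ-pathCount p-isP HH′∈Λ) evenPaths)))
              (MatchingBound.2∣H∣+evenPaths≤order G _ H-matching (x∈p∪q⁺ ∘ inj₁) evenPaths)
    where
    pec = DisjPair-pec (proj₁ HH′∈Λ)
    c = proj₁ (Pec.evenPathCount G _ pec)
    evenPaths = proj₂ (Pec.evenPathCount G _ pec)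

  order≤2μ+eₚ : ∀ {μ eₚ} → IsMu G μ → IsEp G eₚ → n ≤ μ + (μ + eₚ)
  order≤2μ+eₚ {μ} {eₚ} (_ , μ-max) (_ , p-isP , (_ , pec , paths , evenPaths) , _) =
    ℕ.≤-trans (EvenHalfCover.order≤twice-half+evenPaths G _ pec evenPaths)
              (ℕ.+-mono-≤ half≤μ (ℕ.+-monoˡ-≤ eₚ half≤μ))
    where half≤μ = μ-max _ _ (halves-InΛ p-isP pec paths)

mainTheorem9 : ∀ {n m} (G : Graph n m) (ν μ e eₚ : ℕ) →
    IsNu G ν → IsMu G μ → IsE G e → IsEp G eₚ →
    (μ ≡ ν ⇔ e ≡ eₚ)
mainTheorem9 {n} G ν μ e eₚ ν-isNu μ-isMu@((H , _ , HH′∈Λ , ∣H∣≡μ) , _) e-isE eₚ-isEp =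
  mk⇔ μ≡ν⇒e≡eₚ e≡eₚ⇒μ≡ν
  where
  open ℕ.≤-Reasoning
  n≡2ν+e : n ≡ ν + (ν + e)
  n≡2ν+e = order≡2ν+e G ν-isNu e-isE

  μ≡ν⇒e≡eₚ : μ ≡ ν → e ≡ eₚ
  μ≡ν⇒e≡eₚ μ≡ν = ℕ.≤-antisym (e≤eₚ G e-isE eₚ-isEp) (a+a+x≤a+a+y⇒x≤y ν eₚ e (begin
    ν + (ν + eₚ)         ≡⟨ cong (λ k → k + (k + eₚ)) (trans ∣H∣≡μ μ≡ν) ⟨
    ∣ H ∣ + (∣ H ∣ + eₚ) ≤⟨ InΛ⇒2∣H∣+eₚ≤order G eₚ-isEp HH′∈Λ ⟩
    n                    ≡⟨ n≡2ν+e ⟩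
    ν + (ν + e)          ∎))

  e≡eₚ⇒μ≡ν : e ≡ eₚ → μ ≡ ν
  e≡eₚ⇒μ≡ν e≡eₚ = ℕ.≤-antisym (μ≤ν G ν-isNu μ-isMu) (a+a+x≤b+b+x⇒a≤b ν μ e (begin
    ν + (ν + e)          ≡⟨ n≡2ν+e ⟨
    n                    ≤⟨ order≤2μ+eₚ G μ-isMu eₚ-isEp ⟩
    μ + (μ + eₚ)         ≡⟨ cong (λ k → μ + (μ + k)) e≡eₚ ⟨
    μ + (μ + e)          ∎))
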